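{- Let $V$ be a finite set of $n\ge 3$ cities, $E=\binom{V}{2}$, $U=\binom{V}{3}$ (triangles), $W=E$, and let $B=(U\cup W,A)$ be the bipartite incidence graph with $A=\{(t,e): e\subset t\}$. Let $x\in\{0,1\}^U$, $y\in\{0,1\}^W$, $z\in\{0,1\}^A$ satisfy the admissibility constraints (C1)--(C5) stated in the context. Let $K=\{t\in U: x_t=1\}$, viewed as a 2-dimensional abstract simplicial complex on $V$ (together with all edges and vertices of its triangles). Then $K$ is an abstract triangulated disk, and its boundary $\partial K=\{e\in E: \sum_{t\supset e} z_{t,e}=1\}$ is a single simple cycle that is Hamiltonian on $V$ (i.e., passes through every city of $V$ exactly once).
   Context: Admissibility constraints on binary variables $x_t$ ($t\in U$), $y_e$ ($e\in W$), $z_{t,e}$ ($(t,e)\in A$): (C1) for all $(t,e)\in A$: $z_{t,e}\le y_e$ and $z_{t,e}\le x_t$; and for all $t\in U$: $\sum_{e\subset t} z_{t,e}=3x_t$. (C2) for all $e\in W$: $y_e\le \sum_{t\supset e} z_{t,e}\le 2y_e$. (C3) $\sum_{t\in U}x_t=n-2$ and $\sum_{e\in W}y_e=2n-3$. (C4) The active subgraph $B'$ of $B$ — with vertex set $\{t: x_t=1\}\cup\{e: y_e=1\}$ and edge set $\{(t,e)\in A: z_{t,e}=1\}$ — is a tree. (C5) For each city $v\in V$, let $H_v$ be the subgraph of $B'$ induced by the selected triangles containing $v$ and the selected edges containing $v$; then $|V(H_v)|-|E(H_v)|=1$. -}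

module Defs where

open import Data.Bool using (Bool; true; false; T; _∧_; _∨_; if_then_else_)
open import Data.Nat using (ℕ; zero; suc; _+_; _*_; _≤_)
open import Data.Fin using (Fin; _<_; _<?_; toℕ)
import Data.Fin as Fin
open import Data.List using (List; allFin; []; _∷_; [_]; length; concatMap; _∷ʳ_)
open import Data.List.Relation.Unary.Unique.Propositional using (Unique)
open import Data.List.Relation.Unary.Linked using (Linked)
open import Data.List.Membership.Propositional using (_∈_)
open import Data.Fin.Properties using (<-trans)
open import Data.Sum using (_⊎_; inj₁; inj₂)
open import Data.Product using (Σ; _×_; _,_; ∃)
open import Data.Empty using (⊥)
open import Relation.Nullary using (¬_; yes; no; does)
open import Relation.Binary.PropositionalEquality using (_≡_; _≢_)

-- Cities are V = Fin n.  Edges (2-subsets) and triangles (3-subsets)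
-- are represented by their elements listed in strictly increasing order.

record Edge (n : ℕ) : Set where
  constructor edge
  field
    a b : Fin n
    a<b : a < b

record Tri (n : ℕ) : Set where
  constructor tri
  field
    a b c : Fin n
    a<b : a < b
    b<c : b < c

_=ᶠ_ : ∀ {n} → Fin n → Fin n → Bool
u =ᶠ v = does (u Fin.≟ v)

_∈ᵗ_ : ∀ {n} → Fin n → Tri n → Bool
v ∈ᵗ t = (v =ᶠ Tri.a t) ∨ (v =ᶠ Tri.b t) ∨ (v =ᶠ Tri.c t)

_∈ᵉ_ : ∀ {n} → Fin n → Edge n → Bool
v ∈ᵉ e = (v =ᶠ Edge.a e) ∨ (v =ᶠ Edge.b e)

_⊂ᵗ_ : ∀ {n} → Edge n → Tri n → Bool
e ⊂ᵗ t = (Edge.a e ∈ᵗ t) ∧ (Edge.b e ∈ᵗ t)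

mkEdge : ∀ {n} → Fin n → Fin n → List (Edge n)
mkEdge a b with a <? b
... | yes p = [ edge a b p ]
... | no _  = []

mkTri : ∀ {n} → Fin n → Fin n → Fin n → List (Tri n)
mkTri a b c with a <? b | b <? c
... | yes p | yes q = [ tri a b c p q ]
... | _     | _     = []

allEdge : (n : ℕ) → List (Edge n)
allEdge n = concatMap (λ a → concatMap (λ b → mkEdge a b) (allFin n)) (allFin n)

allTri : (n : ℕ) → List (Tri n)
allTri n = concatMap (λ a → concatMap (λ b → concatMap (λ c → mkTri a b c)
             (allFin n)) (allFin n)) (allFin n)

count : ∀ {A : Set} → (A → Bool) → List A → ℕ
count p []       = 0
count p (x ∷ xs) = if p x then suc (count p xs) else count p xs

count₂ : ∀ {n} → (Tri n → Edge n → Bool) → ℕ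
count₂ {n} p = sumT (allTri n)
  where
  sumT : List (Tri n) → ℕ
  sumT []       = 0
  sumT (t ∷ ts) = count (p t) (allEdge n) + sumT ts

b2n : Bool → ℕ
b2n true  = 1
b2n false = 0

data Walk {X : Set} (Adj : X → X → Set) : X → X → Set where
  here : ∀ {u} → Walk Adj u u
  step : ∀ {u v w} → Adj u v → Walk Adj v w → Walk Adj u w

Connected : {X : Set} → (X → Set) → (X → X → Set) → Set
Connected Vt Adj = ∀ u v → Vt u → Vt v → Walk Adj u v

IsCycle : {X : Set} → (X → X → Set) → X → List X → Set
IsCycle Adj v vs = Unique (v ∷ vs) × (2 ≤ length vs) × Linked Adj ((v ∷ vs) ∷ʳ v)

IsTree : {X : Set} → (X → Set) → (X → X → Set) → Set
IsTree {X} Vt Adj =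
  (Σ X Vt) × Connected Vt Adj × (∀ v vs → ¬ IsCycle Adj v vs)

BVert : ∀ {n} → (Tri n → Bool) → (Edge n → Bool) → Tri n ⊎ Edge n → Set
BVert x y (inj₁ t) = T (x t)
BVert x y (inj₂ e) = T (y e)

BAdj : ∀ {n} → (Tri n → Edge n → Bool) → Tri n ⊎ Edge n → Tri n ⊎ Edge n → Set
BAdj z (inj₁ t) (inj₂ e) = T ((e ⊂ᵗ t) ∧ z t e)
BAdj z (inj₂ e) (inj₁ t) = T ((e ⊂ᵗ t) ∧ z t e)
BAdj z _ _ = ⊥

zdeg : ∀ {n} → (Tri n → Edge n → Bool) → Edge n → ℕ
zdeg {n} z e = count (λ t → (e ⊂ᵗ t) ∧ z t e) (allTri n)

C1 : ∀ n → (Tri n → Bool) → (Edge n → Bool) → (Tri n → Edge n → Bool) → Set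
C1 n x y z =
  (∀ t e → T (e ⊂ᵗ t) → T (z t e) → T (y e) × T (x t)) ×
  (∀ t → count (λ e → (e ⊂ᵗ t) ∧ z t e) (allEdge n) ≡ 3 * b2n (x t))

C2 : ∀ n → (Edge n → Bool) → (Tri n → Edge n → Bool) → Set
C2 n y z = ∀ e → (b2n (y e) ≤ zdeg z e) × (zdeg z e ≤ 2 * b2n (y e))

C3 : ∀ n → (Tri n → Bool) → (Edge n → Bool) → Set
C3 n x y = (count x (allTri n) ≡ n Data.Nat.∸ 2) × (count y (allEdge n) ≡ 2 * n Data.Nat.∸ 3)

C4 : ∀ n → (Tri n → Bool) → (Edge n → Bool) → (Tri n → Edge n → Bool) → Set
C4 n x y z = IsTree (BVert x y) (BAdj z)

-- |V(H_v)| = |E(H_v)| + 1, H_v the subgraph of B' induced by the selected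
-- triangles and selected edges containing v
C5 : ∀ n → (Tri n → Bool) → (Edge n → Bool) → (Tri n → Edge n → Bool) → Set
C5 n x y z = ∀ (v : Fin n) →
  count (λ t → x t ∧ (v ∈ᵗ t)) (allTri n) + count (λ e → y e ∧ (v ∈ᵉ e)) (allEdge n)
  ≡ count₂ (λ t e → (e ⊂ᵗ t) ∧ z t e ∧ x t ∧ (v ∈ᵗ t) ∧ y e ∧ (v ∈ᵉ e)) + 1

-- The 2-dimensional complex K generated by a set of triangles, and the
-- notion of an abstract triangulated disk (combinatorial definition:
-- a connected combinatorial surface with nonempty boundary and Euler
-- characteristic 1).

module Complex {n : ℕ} (K : Tri n → Bool) where

  anyL : ∀ {A : Set} → (A → Bool) → List A → Bool
  anyL p []       = false
  anyL p (x ∷ xs) = p x ∨ anyL p xs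

  vertK : Fin n → Bool
  vertK v = anyL (λ t → K t ∧ (v ∈ᵗ t)) (allTri n)

  edgeK : Edge n → Bool
  edgeK e = anyL (λ t → K t ∧ (e ⊂ᵗ t)) (allTri n)

  adjK : Fin n → Fin n → Set
  adjK u v = u ≢ v × T (anyL (λ t → K t ∧ (u ∈ᵗ t) ∧ (v ∈ᵗ t)) (allTri n))

  triDeg : Edge n → ℕ
  triDeg e = count (λ t → K t ∧ (e ⊂ᵗ t)) (allTri n)

  linkVert : Fin n → Fin n → Set
  linkVert v u = adjK v u

  linkAdj : Fin n → Fin n → Fin n → Set
  linkAdj v u w = u ≢ v × w ≢ v × u ≢ w ×
    T (anyL (λ t → K t ∧ (v ∈ᵗ t) ∧ (u ∈ᵗ t) ∧ (w ∈ᵗ t)) (allTri n))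

  IsTriangulatedDisk : Set
  IsTriangulatedDisk =
    (∀ e → T (edgeK e) → (1 ≤ triDeg e) × (triDeg e ≤ 2)) ×
    -- the link of every vertex is connected (hence a path or a cycle)
    (∀ v → T (vertK v) → Connected (linkVert v) (linkAdj v)) ×
    Connected (λ v → T (vertK v)) adjK ×
    -- Euler characteristic χ(K) = V − E + F = 1
    (count vertK (allFin n) + count K (allTri n) ≡ count edgeK (allEdge n) + 1) ×
    (∃ λ e → triDeg e ≡ 1)

Consec : ∀ {X : Set} → List X → X → X → Set
Consec (a ∷ b ∷ rest) u w = (a ≡ u × b ≡ w) ⊎ Consec (b ∷ rest) u w
Consec _ _ _ = ⊥

CycEdge : ∀ {n} → Fin n → List (Fin n) → Edge n → Set
CycEdge v vs e = Consec ((v ∷ vs) ∷ʳ v) (Edge.a e) (Edge.b e)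
               ⊎ Consec ((v ∷ vs) ∷ʳ v) (Edge.b e) (Edge.a e)

IsHamiltonianCycle : ∀ n → (Edge n → Set) → Set
IsHamiltonianCycle n P = ∃ λ (v : Fin n) → ∃ λ (vs : List (Fin n)) →
  Unique (v ∷ vs) × (2 ≤ length vs) × (∀ u → u ∈ (v ∷ vs)) ×
  (∀ e → (P e → CycEdge v vs e) × (CycEdge v vs e → P e))

{-# OPTIONS --safe #-}
module Submission where

-- Eliminating y and z (y_e says e is an edge of K, z_{t,e} = x_t), the constraints say: every
-- edge of K lies in at most two faces, K has n − 2 faces and 2n − 3 edges, each vertex meets
-- one more edge than face (C5), and the face/edge incidence graph B of K is a tree. Double
-- counting then gives every vertex exactly two boundary edges and n boundary edges in all, so
-- some face has two boundary edges: an ear. Acyclicity of B keeps the apex of an ear out of all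
-- other faces, so deleting the ear and its apex preserves the constraints, and induction on |K|
-- yields connected vertex links and a connected boundary. A connected 2-regular boundary graph
-- through all n vertices is a Hamiltonian cycle, and χ(K) = n − (2n − 3) + (n − 2) = 1.

open import Defs
open import Data.Bool using (Bool; true; false; T; _∧_; _∨_; not)
open import Data.Bool.Properties using (T-∧; T-∨; T-≡; T?; ∧-identityʳ; ∧-commutativeMonoid)
open import Data.Empty using (⊥; ⊥-elim)
open import Data.Fin using (Fin)
import Data.Fin as Fin
import Data.Fin.Properties as Finₚ
open import Data.List using (List; []; _∷_; [_]; _++_; map; concatMap; allFin; length; _∷ʳ_)
import Data.List.Properties as Listₚ
open import Data.List.Membership.Propositional using (_∈_; _∉_)
open import Data.List.Membership.Propositional.Properties
  using (∈-map⁺; ∈-map⁻; ∈-concat⁺′; ∈-concat⁻′; ∈-allFin; ∈-++⁺ˡ; ∈-++⁺ʳ; ∈-++⁻; ∈-∃++)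
import Data.List.Membership.DecPropositional as DecMembership
open import Data.List.Relation.Unary.Any using (here; there)
open import Data.List.Relation.Unary.All using (All; []; _∷_)
open import Data.List.Relation.Unary.All.Properties using (¬Any⇒All¬)
open import Data.List.Relation.Unary.AllPairs as AllPairs using ([]; _∷_)
open import Data.List.Relation.Unary.Unique.Propositional using (Unique)
open import Data.List.Relation.Unary.Unique.Propositional.Properties
  using (allFin⁺; ++⁺; Unique[x∷xs]⇒x∉xs)
open import Data.List.Relation.Unary.Linked as Linked using (Linked; []; [-]; _∷_)
open import Data.Nat using (ℕ; zero; suc; _+_; _*_; _≤_; _<_; z≤n; s≤s; _≡ᵇ_)
import Data.Nat.Properties as ℕₚ
open import Data.Nat.Solver using (module +-*-Solver)
open import Algebra.Bundles using (CommutativeMonoid)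
open import Algebra.Properties.CommutativeSemigroup (CommutativeMonoid.commutativeSemigroup ∧-commutativeMonoid)
  using () renaming (xy∙z≈xz∙y to ∧-swapʳ)
open import Algebra.Properties.CommutativeSemigroup ℕₚ.+-commutativeSemigroup
  using () renaming (interchange to +-interchange)
open import Data.Product using (Σ; ∃; _×_; _,_; proj₁; proj₂)
open import Data.Sum using (_⊎_; inj₁; inj₂; [_,_]′)
import Data.Sum.Properties as Sumₚ
open import Data.Unit using (⊤; tt)
open import Function.Bundles using (Equivalence)
open import Relation.Binary.Definitions using (DecidableEquality; tri<; tri≈; tri>)
open import Relation.Binary.PropositionalEquality
  using (_≡_; _≢_; refl; sym; trans; cong; cong₂; subst; subst₂; module ≡-Reasoning)
open import Relation.Nullary using (¬_; yes; no; does)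
open ≡-Reasoning

T-∧-intro : ∀ {x y} → T x → T y → T (x ∧ y)
T-∧-intro {x} {y} p q = Equivalence.from (T-∧ {x} {y}) (p , q)

T-∧-l : ∀ {x y} → T (x ∧ y) → T x
T-∧-l {x} {y} h = proj₁ (Equivalence.to (T-∧ {x} {y}) h)

T-∧-r : ∀ {x y} → T (x ∧ y) → T y
T-∧-r {x} {y} h = proj₂ (Equivalence.to (T-∧ {x} {y}) h)

T-∨-elim : ∀ {x y} → T (x ∨ y) → T x ⊎ T y
T-∨-elim {x} {y} = Equivalence.to (T-∨ {x} {y})

T-∨-l : ∀ {x y} → T x → T (x ∨ y)
T-∨-l {x} {y} p = Equivalence.from (T-∨ {x} {y}) (inj₁ p)

T-∨-r : ∀ {x y} → T y → T (x ∨ y)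
T-∨-r {x} {y} p = Equivalence.from (T-∨ {x} {y}) (inj₂ p)

T-true : ∀ {x} → T x → x ≡ true
T-true {x} = Equivalence.to (T-≡ {x})

true-T : ∀ {x} → x ≡ true → T x
true-T {x} = Equivalence.from (T-≡ {x})

T-false : ∀ {x} → ¬ T x → x ≡ false
T-false {true} h = ⊥-elim (h tt)
T-false {false} _ = refl

T-ext : ∀ {x y} → (T x → T y) → (T y → T x) → x ≡ y
T-ext {true} {true} _ _ = refl
T-ext {true} {false} f _ = ⊥-elim (f tt)
T-ext {false} {true} _ g = ⊥-elim (g tt)
T-ext {false} {false} _ _ = refl

b2n-T : ∀ {b} → T b → b2n b ≡ 1
b2n-T {true} _ = refl

b2n-F : ∀ {b} → ¬ T b → b2n b ≡ 0
b2n-F {b} h = cong b2n (T-false h)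

b2n≤1 : ∀ b → b2n b ≤ 1
b2n≤1 true = s≤s z≤n
b2n≤1 false = z≤n

module _ {N : ℕ} where

  =ᶠ-refl : ∀ (v : Fin N) → T (v =ᶠ v)
  =ᶠ-refl v with v Fin.≟ v
  ... | yes _ = tt
  ... | no ¬p = ¬p refl

  =ᶠ-sound : ∀ {u v : Fin N} → T (u =ᶠ v) → u ≡ v
  =ᶠ-sound {u} {v} h with u Fin.≟ v
  ... | yes p = p

  edge-≡ : ∀ {e f : Edge N} → Edge.a e ≡ Edge.a f → Edge.b e ≡ Edge.b f → e ≡ f
  edge-≡ {edge a b p} {edge .a .b p′} refl refl = cong (edge a b) (Finₚ.<-irrelevant p p′)

  tri-≡ : ∀ {t s : Tri N} → Tri.a t ≡ Tri.a s → Tri.b t ≡ Tri.b s → Tri.c t ≡ Tri.c s → t ≡ s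
  tri-≡ {tri a b c p q} {tri .a .b .c p′ q′} refl refl refl =
    cong₂ (tri a b c) (Finₚ.<-irrelevant p p′) (Finₚ.<-irrelevant q q′)

  _≟E_ : DecidableEquality (Edge N)
  e ≟E f with Edge.a e Fin.≟ Edge.a f | Edge.b e Fin.≟ Edge.b f
  ... | yes p | yes q = yes (edge-≡ p q)
  ... | no ¬p | _ = no (λ eq → ¬p (cong Edge.a eq))
  ... | yes _ | no ¬q = no (λ eq → ¬q (cong Edge.b eq))

  _≟T_ : DecidableEquality (Tri N)
  t ≟T s with Tri.a t Fin.≟ Tri.a s | Tri.b t Fin.≟ Tri.b s | Tri.c t Fin.≟ Tri.c s
  ... | yes p | yes q | yes r = yes (tri-≡ p q r)
  ... | no ¬p | _ | _ = no (λ eq → ¬p (cong Tri.a eq))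
  ... | yes _ | no ¬q | _ = no (λ eq → ¬q (cong Tri.b eq))
  ... | yes _ | yes _ | no ¬r = no (λ eq → ¬r (cong Tri.c eq))

  ∈ᵗ-sound : ∀ {v : Fin N} {t : Tri N} → T (v ∈ᵗ t) → v ≡ Tri.a t ⊎ v ≡ Tri.b t ⊎ v ≡ Tri.c t
  ∈ᵗ-sound {v} {t} h with T-∨-elim {v =ᶠ Tri.a t} h
  ... | inj₁ h1 = inj₁ (=ᶠ-sound h1)
  ... | inj₂ h2 with T-∨-elim {v =ᶠ Tri.b t} h2
  ... | inj₁ h3 = inj₂ (inj₁ (=ᶠ-sound h3))
  ... | inj₂ h4 = inj₂ (inj₂ (=ᶠ-sound h4))

  ∈ᵗ-a : ∀ (t : Tri N) → T (Tri.a t ∈ᵗ t)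
  ∈ᵗ-a t = T-∨-l (=ᶠ-refl (Tri.a t))

  ∈ᵗ-b : ∀ (t : Tri N) → T (Tri.b t ∈ᵗ t)
  ∈ᵗ-b t = T-∨-r {Tri.b t =ᶠ Tri.a t} (T-∨-l (=ᶠ-refl (Tri.b t)))

  ∈ᵗ-c : ∀ (t : Tri N) → T (Tri.c t ∈ᵗ t)
  ∈ᵗ-c t = T-∨-r {Tri.c t =ᶠ Tri.a t} (T-∨-r {Tri.c t =ᶠ Tri.b t} (=ᶠ-refl (Tri.c t)))

  ∈ᵉ-sound : ∀ {v : Fin N} {e : Edge N} → T (v ∈ᵉ e) → v ≡ Edge.a e ⊎ v ≡ Edge.b e
  ∈ᵉ-sound {v} {e} h with T-∨-elim {v =ᶠ Edge.a e} h
  ... | inj₁ h1 = inj₁ (=ᶠ-sound h1)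
  ... | inj₂ h2 = inj₂ (=ᶠ-sound h2)

  ∈ᵉ-a : ∀ (e : Edge N) → T (Edge.a e ∈ᵉ e)
  ∈ᵉ-a e = T-∨-l (=ᶠ-refl (Edge.a e))

  ∈ᵉ-b : ∀ (e : Edge N) → T (Edge.b e ∈ᵉ e)
  ∈ᵉ-b e = T-∨-r {Edge.b e =ᶠ Edge.a e} (=ᶠ-refl (Edge.b e))

  ⊂ᵗ-intro : ∀ {e : Edge N} {t : Tri N} → T (Edge.a e ∈ᵗ t) → T (Edge.b e ∈ᵗ t) → T (e ⊂ᵗ t)
  ⊂ᵗ-intro h1 h2 = T-∧-intro h1 h2

  ⊂ᵗ-a : ∀ {e : Edge N} {t : Tri N} → T (e ⊂ᵗ t) → T (Edge.a e ∈ᵗ t)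
  ⊂ᵗ-a {e} {t} h = T-∧-l {Edge.a e ∈ᵗ t} h

  ⊂ᵗ-b : ∀ {e : Edge N} {t : Tri N} → T (e ⊂ᵗ t) → T (Edge.b e ∈ᵗ t)
  ⊂ᵗ-b {e} {t} h = T-∧-r {Edge.a e ∈ᵗ t} h

  ∈-⊂ : ∀ {v : Fin N} {e : Edge N} {t : Tri N} → T (v ∈ᵉ e) → T (e ⊂ᵗ t) → T (v ∈ᵗ t)
  ∈-⊂ {v} {e} {t} h s with ∈ᵉ-sound {v} {e} h
  ... | inj₁ refl = ⊂ᵗ-a {e} {t} s
  ... | inj₂ refl = ⊂ᵗ-b {e} {t} s

  eAB eAC eBC : Tri N → Edge N
  eAB (tri a b c p q) = edge a b p
  eAC (tri a b c p q) = edge a c (Finₚ.<-trans p q)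
  eBC (tri a b c p q) = edge b c q

  eAB⊂ : ∀ t → T (eAB t ⊂ᵗ t)
  eAB⊂ t@(tri a b c p q) = ⊂ᵗ-intro {eAB t} {t} (∈ᵗ-a t) (∈ᵗ-b t)

  eAC⊂ : ∀ t → T (eAC t ⊂ᵗ t)
  eAC⊂ t@(tri a b c p q) = ⊂ᵗ-intro {eAC t} {t} (∈ᵗ-a t) (∈ᵗ-c t)

  eBC⊂ : ∀ t → T (eBC t ⊂ᵗ t)
  eBC⊂ t@(tri a b c p q) = ⊂ᵗ-intro {eBC t} {t} (∈ᵗ-b t) (∈ᵗ-c t)

  a≢b-T : ∀ (t : Tri N) → Tri.a t ≢ Tri.b t
  a≢b-T (tri a b c p q) eq = Finₚ.<-irrefl eq p

  a≢c-T : ∀ (t : Tri N) → Tri.a t ≢ Tri.c t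
  a≢c-T (tri a b c p q) eq = Finₚ.<-irrefl eq (Finₚ.<-trans p q)

  b≢c-T : ∀ (t : Tri N) → Tri.b t ≢ Tri.c t
  b≢c-T (tri a b c p q) eq = Finₚ.<-irrefl eq q

  a≢b-E : ∀ (e : Edge N) → Edge.a e ≢ Edge.b e
  a≢b-E (edge a b p) eq = Finₚ.<-irrefl eq p

  ⊂ᵗ-sound : ∀ {e : Edge N} {t : Tri N} → T (e ⊂ᵗ t) → e ≡ eAB t ⊎ e ≡ eAC t ⊎ e ≡ eBC t
  ⊂ᵗ-sound {e@(edge x y x<y)} {t@(tri a b c p q)} h
    with ∈ᵗ-sound {x} {t} (⊂ᵗ-a {e} {t} h) | ∈ᵗ-sound {y} {t} (⊂ᵗ-b {e} {t} h)
  ... | inj₁ refl | inj₁ refl = ⊥-elim (Finₚ.<-irrefl refl x<y)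
  ... | inj₁ refl | inj₂ (inj₁ refl) = inj₁ (edge-≡ refl refl)
  ... | inj₁ refl | inj₂ (inj₂ refl) = inj₂ (inj₁ (edge-≡ refl refl))
  ... | inj₂ (inj₁ refl) | inj₁ refl = ⊥-elim (Finₚ.<-asym x<y p)
  ... | inj₂ (inj₁ refl) | inj₂ (inj₁ refl) = ⊥-elim (Finₚ.<-irrefl refl x<y)
  ... | inj₂ (inj₁ refl) | inj₂ (inj₂ refl) = inj₂ (inj₂ (edge-≡ refl refl))
  ... | inj₂ (inj₂ refl) | inj₁ refl = ⊥-elim (Finₚ.<-asym x<y (Finₚ.<-trans p q))
  ... | inj₂ (inj₂ refl) | inj₂ (inj₁ refl) = ⊥-elim (Finₚ.<-asym x<y q)
  ... | inj₂ (inj₂ refl) | inj₂ (inj₂ refl) = ⊥-elim (Finₚ.<-irrefl refl x<y)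

  eAB≢eAC : ∀ (t : Tri N) → eAB t ≢ eAC t
  eAB≢eAC t eq = b≢c-T t (cong Edge.b eq)

  eAB≢eBC : ∀ (t : Tri N) → eAB t ≢ eBC t
  eAB≢eBC t eq = a≢b-T t (cong Edge.a eq)

  eAC≢eBC : ∀ (t : Tri N) → eAC t ≢ eBC t
  eAC≢eBC t eq = a≢b-T t (cong Edge.a eq)

Unique-cons : ∀ {A : Set} {x : A} {xs} → x ∉ xs → Unique xs → Unique (x ∷ xs)
Unique-cons x∉xs u = ¬Any⇒All¬ _ x∉xs ∷ u

Unique-++⁻ˡ : ∀ {A : Set} (xs : List A) {ys} → Unique (xs ++ ys) → Unique xs
Unique-++⁻ˡ [] _ = []
Unique-++⁻ˡ (x ∷ xs) u@(_ ∷ u′) =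
  Unique-cons (λ m → Unique[x∷xs]⇒x∉xs u (∈-++⁺ˡ m)) (Unique-++⁻ˡ xs u′)

Unique-++⇒disjoint : ∀ {A : Set} (xs : List A) {ys} {v} → Unique (xs ++ ys) → v ∈ xs → v ∉ ys
Unique-++⇒disjoint (x ∷ xs) u (here refl) m = Unique[x∷xs]⇒x∉xs u (∈-++⁺ʳ xs m)
Unique-++⇒disjoint (x ∷ xs) (_ ∷ u) (there m₁) m₂ = Unique-++⇒disjoint xs u m₁ m₂

∈-concatMap⁻ : ∀ {A B : Set} (g : A → List B) (L : List A) {y} → y ∈ concatMap g L → ∃ λ k → k ∈ L × y ∈ g k
∈-concatMap⁻ g L m with ∈-concat⁻′ (map g L) m
... | xs , y∈xs , xs∈ with ∈-map⁻ g xs∈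
... | k , k∈L , refl = k , k∈L , y∈xs

∈-concatMap⁺ : ∀ {A B : Set} (g : A → List B) {L : List A} {y} {k} → k ∈ L → y ∈ g k → y ∈ concatMap g L
∈-concatMap⁺ g k∈L y∈ = ∈-concat⁺′ y∈ (∈-map⁺ g k∈L)

-- The blocks g k are told apart by the key of their elements.
Unique-concatMap : ∀ {A B : Set} (key : B → A) (g : A → List B) (L : List A) → Unique L →
  (∀ k → Unique (g k)) → (∀ k y → y ∈ g k → key y ≡ k) → Unique (concatMap g L)
Unique-concatMap key g [] _ _ _ = []
Unique-concatMap key g (k ∷ L) uL@(_ ∷ uL′) ug hk =
  ++⁺ (ug k) (Unique-concatMap key g L uL′ ug hk) disjoint
  where
  disjoint : ∀ {v} → ¬ (v ∈ g k × v ∈ concatMap g L)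
  disjoint {v} (m₁ , m₂) with ∈-concatMap⁻ g L m₂
  ... | k′ , k′∈ , m₃ = Unique[x∷xs]⇒x∉xs uL (subst (_∈ L) (trans (sym (hk k′ v m₃)) (hk k v m₁)) k′∈)

module _ {N : ℕ} where

  mkEdge-key : ∀ {a b : Fin N} {y} → y ∈ mkEdge a b → Edge.a y ≡ a × Edge.b y ≡ b
  mkEdge-key {a} {b} m with a Fin.<? b
  mkEdge-key {a} {b} (here refl) | yes p = refl , refl

  mkEdge-unique : ∀ (a b : Fin N) → Unique (mkEdge a b)
  mkEdge-unique a b with a Fin.<? b
  ... | yes p = [] ∷ []
  ... | no _ = []

  mkEdge-complete : ∀ (e : Edge N) → e ∈ mkEdge (Edge.a e) (Edge.b e)
  mkEdge-complete (edge a b p) with a Fin.<? b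
  ... | yes p′ = here (cong (edge a b) (Finₚ.<-irrelevant p p′))
  ... | no ¬p = ⊥-elim (¬p p)

  allEdge-complete : ∀ (e : Edge N) → e ∈ allEdge N
  allEdge-complete e =
    ∈-concatMap⁺ (λ a → concatMap (mkEdge a) (allFin N)) (∈-allFin (Edge.a e))
      (∈-concatMap⁺ (mkEdge (Edge.a e)) (∈-allFin (Edge.b e)) (mkEdge-complete e))

  allEdge-unique : Unique (allEdge N)
  allEdge-unique = Unique-concatMap Edge.a row (allFin N) (allFin⁺ N) row-unique row-key
    where
    row : Fin N → List (Edge N)
    row a = concatMap (mkEdge a) (allFin N)
    row-unique : ∀ a → Unique (row a)
    row-unique a = Unique-concatMap Edge.b (mkEdge a) (allFin N) (allFin⁺ N) (mkEdge-unique a)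
                     (λ b y m → proj₂ (mkEdge-key m))
    row-key : ∀ a y → y ∈ row a → Edge.a y ≡ a
    row-key a y m with ∈-concatMap⁻ (mkEdge a) (allFin N) m
    ... | b , _ , m′ = proj₁ (mkEdge-key m′)

  mkTri-key : ∀ {a b c : Fin N} {y} → y ∈ mkTri a b c → Tri.a y ≡ a × Tri.b y ≡ b × Tri.c y ≡ c
  mkTri-key {a} {b} {c} m with a Fin.<? b | b Fin.<? c
  mkTri-key (here refl) | yes p | yes q = refl , refl , refl

  mkTri-unique : ∀ (a b c : Fin N) → Unique (mkTri a b c)
  mkTri-unique a b c with a Fin.<? b | b Fin.<? c
  ... | yes p | yes q = [] ∷ []
  ... | yes p | no _ = []
  ... | no _ | _ = []

  mkTri-complete : ∀ (t : Tri N) → t ∈ mkTri (Tri.a t) (Tri.b t) (Tri.c t)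
  mkTri-complete (tri a b c p q) with a Fin.<? b | b Fin.<? c
  ... | yes p′ | yes q′ = here (cong₂ (tri a b c) (Finₚ.<-irrelevant p p′) (Finₚ.<-irrelevant q q′))
  ... | yes p′ | no ¬q = ⊥-elim (¬q q)
  ... | no ¬p | _ = ⊥-elim (¬p p)

  allTri-complete : ∀ (t : Tri N) → t ∈ allTri N
  allTri-complete t =
    ∈-concatMap⁺ (λ a → concatMap (λ b → concatMap (mkTri a b) (allFin N)) (allFin N)) (∈-allFin (Tri.a t))
      (∈-concatMap⁺ (λ b → concatMap (mkTri (Tri.a t) b) (allFin N)) (∈-allFin (Tri.b t))
        (∈-concatMap⁺ (mkTri (Tri.a t) (Tri.b t)) (∈-allFin (Tri.c t)) (mkTri-complete t)))

  allTri-unique : Unique (allTri N)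
  allTri-unique = Unique-concatMap Tri.a slab (allFin N) (allFin⁺ N) slab-unique slab-key
    where
    row : Fin N → Fin N → List (Tri N)
    row a b = concatMap (mkTri a b) (allFin N)
    slab : Fin N → List (Tri N)
    slab a = concatMap (row a) (allFin N)
    row-unique : ∀ a b → Unique (row a b)
    row-unique a b = Unique-concatMap Tri.c (mkTri a b) (allFin N) (allFin⁺ N) (mkTri-unique a b)
                       (λ c y m → proj₂ (proj₂ (mkTri-key m)))
    row-key : ∀ a b y → y ∈ row a b → Tri.a y ≡ a × Tri.b y ≡ b
    row-key a b y m with ∈-concatMap⁻ (mkTri a b) (allFin N) m
    ... | c , _ , m′ = proj₁ (mkTri-key m′) , proj₁ (proj₂ (mkTri-key m′))
    slab-unique : ∀ a → Unique (slab a)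
    slab-unique a = Unique-concatMap Tri.b (row a) (allFin N) (allFin⁺ N) (row-unique a)
                      (λ b y m → proj₂ (row-key a b y m))
    slab-key : ∀ a y → y ∈ slab a → Tri.a y ≡ a
    slab-key a y m with ∈-concatMap⁻ (row a) (allFin N) m
    ... | b , _ , m′ = proj₁ (row-key a b y m′)

sumL : ∀ {A : Set} → (A → ℕ) → List A → ℕ
sumL f [] = 0
sumL f (x ∷ xs) = f x + sumL f xs

module _ {A : Set} where

  count-∷ : ∀ (p : A → Bool) x xs → count p (x ∷ xs) ≡ b2n (p x) + count p xs
  count-∷ p x xs with p x
  ... | true = refl
  ... | false = refl

  count≡sumL : ∀ (p : A → Bool) L → count p L ≡ sumL (λ x → b2n (p x)) L
  count≡sumL p [] = refl
  count≡sumL p (x ∷ xs) = trans (count-∷ p x xs) (cong (b2n (p x) +_) (count≡sumL p xs))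

  count-ext : ∀ {p q : A → Bool} L → (∀ x → x ∈ L → p x ≡ q x) → count p L ≡ count q L
  count-ext {p} {q} [] h = refl
  count-ext {p} {q} (x ∷ xs) h = begin
    count p (x ∷ xs)          ≡⟨ count-∷ p x xs ⟩
    b2n (p x) + count p xs    ≡⟨ cong₂ _+_ (cong b2n (h x (here refl))) (count-ext xs (λ y m → h y (there m))) ⟩
    b2n (q x) + count q xs    ≡⟨ count-∷ q x xs ⟨
    count q (x ∷ xs)          ∎

  count-true : ∀ L → count (λ (_ : A) → true) L ≡ length L
  count-true [] = refl
  count-true (x ∷ xs) = cong suc (count-true xs)

  sumL-ext : ∀ {f g : A → ℕ} L → (∀ x → x ∈ L → f x ≡ g x) → sumL f L ≡ sumL g L
  sumL-ext [] h = refl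
  sumL-ext (x ∷ xs) h = cong₂ _+_ (h x (here refl)) (sumL-ext xs (λ y m → h y (there m)))

  sumL-0 : ∀ (L : List A) → sumL (λ _ → 0) L ≡ 0
  sumL-0 [] = refl
  sumL-0 (x ∷ xs) = sumL-0 xs

  sumL-+ : ∀ (f g : A → ℕ) L → sumL (λ x → f x + g x) L ≡ sumL f L + sumL g L
  sumL-+ f g [] = refl
  sumL-+ f g (x ∷ xs) rewrite sumL-+ f g xs = +-interchange (f x) (g x) (sumL f xs) (sumL g xs)

  sumL-* : ∀ c (f : A → ℕ) L → sumL (λ x → c * f x) L ≡ c * sumL f L
  sumL-* c f [] = sym (ℕₚ.*-zeroʳ c)
  sumL-* c f (x ∷ xs) rewrite sumL-* c f xs = sym (ℕₚ.*-distribˡ-+ c (f x) (sumL f xs))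

  sumL-find-< : ∀ (f g : A → ℕ) L → sumL g L < sumL f L → Σ A λ x → x ∈ L × g x < f x
  sumL-find-< f g (x ∷ xs) h with g x ℕₚ.<? f x
  ... | yes p = x , here refl , p
  ... | no ¬p with sumL-find-< f g xs (ℕₚ.+-cancelˡ-< (f x) (sumL g xs) (sumL f xs)
                      (ℕₚ.≤-<-trans (ℕₚ.+-monoˡ-≤ (sumL g xs) (ℕₚ.≮⇒≥ ¬p)) h))
  ... | y , m , q = y , there m , q

  count-zero : ∀ (p : A → Bool) L → (∀ x → x ∈ L → ¬ T (p x)) → count p L ≡ 0
  count-zero p [] h = refl
  count-zero p (x ∷ xs) h rewrite count-∷ p x xs | T-false (h x (here refl)) =
    count-zero p xs (λ y m → h y (there m))

  count≥1⇒∃ : ∀ (p : A → Bool) L → 1 ≤ count p L → Σ A λ x → x ∈ L × T (p x)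
  count≥1⇒∃ p (x ∷ xs) h with T? (p x)
  ... | yes px = x , here refl , px
  ... | no ¬px rewrite count-∷ p x xs | T-false ¬px with count≥1⇒∃ p xs h
  ... | y , m , py = y , there m , py

  ∃⇒count≥1 : ∀ (p : A → Bool) L {x} → x ∈ L → T (p x) → 1 ≤ count p L
  ∃⇒count≥1 p (w ∷ ws) (here refl) h rewrite count-∷ p w ws | T-true h = s≤s z≤n
  ∃⇒count≥1 p (w ∷ ws) (there m) h rewrite count-∷ p w ws =
    ℕₚ.≤-trans (∃⇒count≥1 p ws m h) (ℕₚ.m≤n+m _ (b2n (p w)))

sumL-swap : ∀ {A B : Set} (f : A → B → ℕ) L₁ L₂ →
  sumL (λ a → sumL (f a) L₂) L₁ ≡ sumL (λ b → sumL (λ a → f a b) L₁) L₂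
sumL-swap f [] L₂ = sym (sumL-0 L₂)
sumL-swap f (a ∷ L₁) L₂ = trans (cong (sumL (f a) L₂ +_) (sumL-swap f L₁ L₂))
  (sym (sumL-+ (f a) (λ b → sumL (λ a′ → f a′ b) L₁) L₂))

module Removal {A : Set} (_≟_ : DecidableEquality A) where

  infixl 6 _∖_
  _∖_ : (A → Bool) → A → A → Bool
  (p ∖ m) x = p x ∧ not (does (x ≟ m))

  ≢⇒T-not : ∀ {x m} → x ≢ m → T (not (does (x ≟ m)))
  ≢⇒T-not {x} {m} ne with x ≟ m
  ... | yes eq = ne eq
  ... | no _ = tt

  T-not⇒≢ : ∀ {x m} → T (not (does (x ≟ m))) → x ≢ m
  T-not⇒≢ {x} {m} h eq with x ≟ m
  ... | no ne = ne eq

  ∖-≢ : ∀ (p : A → Bool) m x → x ≢ m → (p ∖ m) x ≡ p x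
  ∖-≢ p m x ne with x ≟ m
  ... | yes eq = ⊥-elim (ne eq)
  ... | no _ = ∧-identityʳ (p x)

  ∖-self : ∀ (p : A → Bool) m → (p ∖ m) m ≡ false
  ∖-self p m with m ≟ m
  ... | no ne = ⊥-elim (ne refl)
  ... | yes _ with p m
  ...   | true = refl
  ...   | false = refl

  count-∖ : ∀ (p : A → Bool) L m → Unique L → m ∈ L → count p L ≡ count (p ∖ m) L + b2n (p m)
  count-∖ p (y ∷ L) m u (here refl) = begin
    count p (m ∷ L)                                   ≡⟨ count-∷ p m L ⟩
    b2n (p m) + count p L                             ≡⟨ ℕₚ.+-comm (b2n (p m)) _ ⟩
    count p L + b2n (p m)                             ≡⟨ cong (_+ b2n (p m)) (count-ext L away) ⟩
    count (p ∖ m) L + b2n (p m)                       ≡⟨ cong (λ z → b2n z + count (p ∖ m) L + b2n (p m)) (∖-self p m) ⟨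
    b2n ((p ∖ m) m) + count (p ∖ m) L + b2n (p m)     ≡⟨ cong (_+ b2n (p m)) (count-∷ (p ∖ m) m L) ⟨
    count (p ∖ m) (m ∷ L) + b2n (p m)                 ∎
    where
    away : ∀ x → x ∈ L → p x ≡ (p ∖ m) x
    away x x∈L = sym (∖-≢ p m x (λ eq → Unique[x∷xs]⇒x∉xs u (subst (_∈ L) eq x∈L)))
  count-∖ p (y ∷ L) m u@(_ ∷ u′) (there m∈L) = begin
    count p (y ∷ L)                                   ≡⟨ count-∷ p y L ⟩
    b2n (p y) + count p L                             ≡⟨ cong (b2n (p y) +_) (count-∖ p L m u′ m∈L) ⟩
    b2n (p y) + (count (p ∖ m) L + b2n (p m))         ≡⟨ ℕₚ.+-assoc (b2n (p y)) _ _ ⟨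
    b2n (p y) + count (p ∖ m) L + b2n (p m)           ≡⟨ cong (λ z → b2n z + count (p ∖ m) L + b2n (p m)) (∖-≢ p m y y≢m) ⟨
    b2n ((p ∖ m) y) + count (p ∖ m) L + b2n (p m)     ≡⟨ cong (_+ b2n (p m)) (count-∷ (p ∖ m) y L) ⟨
    count (p ∖ m) (y ∷ L) + b2n (p m)                 ∎
    where
    y≢m : y ≢ m
    y≢m eq = Unique[x∷xs]⇒x∉xs u (subst (_∈ L) (sym eq) m∈L)

  count-∖-T : ∀ (p : A → Bool) L m → Unique L → m ∈ L → T (p m) → count p L ≡ count (p ∖ m) L + 1
  count-∖-T p L m u m∈L pm = trans (count-∖ p L m u m∈L) (cong (count (p ∖ m) L +_) (b2n-T pm))

  count-restrict : ∀ (p : A → Bool) L M → Unique L → Unique M → (∀ x → x ∈ M → x ∈ L) →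
                   (∀ x → x ∈ L → T (p x) → x ∈ M) → count p L ≡ count p M
  count-restrict p L [] uL uM sub sup = count-zero p L (λ x m px → absurd (sup x m px))
    where
    absurd : ∀ {x} → x ∈ [] → ⊥
    absurd ()
  count-restrict p L (m ∷ M) uL uM@(_ ∷ uM′) sub sup = begin
    count p L                       ≡⟨ count-∖ p L m uL (sub m (here refl)) ⟩
    count (p ∖ m) L + b2n (p m)     ≡⟨ cong (_+ b2n (p m)) (count-restrict (p ∖ m) L M uL uM′ (λ x mx → sub x (there mx)) sup′) ⟩
    count (p ∖ m) M + b2n (p m)     ≡⟨ cong (_+ b2n (p m)) (count-ext M kept) ⟩
    count p M + b2n (p m)           ≡⟨ ℕₚ.+-comm (count p M) _ ⟩
    b2n (p m) + count p M           ≡⟨ count-∷ p m M ⟨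
    count p (m ∷ M)                 ∎
    where
    kept : ∀ x → x ∈ M → (p ∖ m) x ≡ p x
    kept x x∈M = ∖-≢ p m x (λ eq → Unique[x∷xs]⇒x∉xs uM (subst (_∈ M) eq x∈M))
    sup′ : ∀ x → x ∈ L → T ((p ∖ m) x) → x ∈ M
    sup′ x mx h with sup x mx (T-∧-l {p x} h)
    ... | here refl = ⊥-elim (T-not⇒≢ (T-∧-r {p x} h) refl)
    ... | there m′ = m′

  count≥2⇒pair : ∀ (p : A → Bool) L → Unique L → 2 ≤ count p L →
    Σ A λ x → Σ A λ y → x ≢ y × x ∈ L × y ∈ L × T (p x) × T (p y)
  count≥2⇒pair p L u h with count≥1⇒∃ p L (ℕₚ.≤-trans (s≤s z≤n) h)
  ... | x , x∈L , px with count≥1⇒∃ (p ∖ x) L (ℕₚ.+-cancelʳ-≤ 1 1 (count (p ∖ x) L)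
                            (subst (2 ≤_) (count-∖-T p L x u x∈L px) h))
  ... | y , y∈L , py′ = x , y , (λ eq → T-not⇒≢ (T-∧-r {p y} py′) (sym eq)) , x∈L , y∈L , px , T-∧-l {p y} py′

  pair⇒count≥2 : ∀ (p : A → Bool) L → Unique L → ∀ x y → x ≢ y → x ∈ L → y ∈ L →
    T (p x) → T (p y) → 2 ≤ count p L
  pair⇒count≥2 p L u x y x≢y x∈L y∈L px py =
    subst (2 ≤_) (sym (count-∖-T p L x u x∈L px))
      (ℕₚ.+-monoˡ-≤ 1 (∃⇒count≥1 (p ∖ x) L y∈L (true-T (trans (∖-≢ p x y (λ e → x≢y (sym e))) (T-true py)))))

  triple⇒count≥3 : ∀ (p : A → Bool) L → Unique L → ∀ x y z → x ≢ y → x ≢ z → y ≢ z →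
    x ∈ L → y ∈ L → z ∈ L → T (p x) → T (p y) → T (p z) → 3 ≤ count p L
  triple⇒count≥3 p L u x y z x≢y x≢z y≢z x∈L y∈L z∈L px py pz =
    subst (3 ≤_) (sym (count-∖-T p L x u x∈L px))
      (ℕₚ.+-monoˡ-≤ 1 (pair⇒count≥2 (p ∖ x) L u y z y≢z y∈L z∈L
        (true-T (trans (∖-≢ p x y (λ e → x≢y (sym e))) (T-true py)))
        (true-T (trans (∖-≢ p x z (λ e → x≢z (sym e))) (T-true pz)))))

  count-∖∖ : ∀ (p : A → Bool) L m₁ m₂ → Unique L → m₁ ∈ L → m₂ ∈ L → m₁ ≢ m₂ →
    count p L ≡ count (p ∖ m₁ ∖ m₂) L + b2n (p m₂) + b2n (p m₁)
  count-∖∖ p L m₁ m₂ u m₁∈L m₂∈L m₁≢m₂ = begin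
    count p L                                           ≡⟨ count-∖ p L m₁ u m₁∈L ⟩
    count (p ∖ m₁) L + b2n (p m₁)                       ≡⟨ cong (_+ b2n (p m₁)) (count-∖ (p ∖ m₁) L m₂ u m₂∈L) ⟩
    count (p ∖ m₁ ∖ m₂) L + b2n ((p ∖ m₁) m₂) + b2n (p m₁)
      ≡⟨ cong (λ k → count (p ∖ m₁ ∖ m₂) L + b2n k + b2n (p m₁)) (∖-≢ p m₁ m₂ (λ eq → m₁≢m₂ (sym eq))) ⟩
    count (p ∖ m₁ ∖ m₂) L + b2n (p m₂) + b2n (p m₁)     ∎

module _ {X : Set} {Adj : X → X → Set} where

  walk-++ : ∀ {u v w} → Walk Adj u v → Walk Adj v w → Walk Adj u w
  walk-++ here q = q
  walk-++ (step a p) q = step a (walk-++ p q)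

  walk-rev : (∀ {x y} → Adj x y → Adj y x) → ∀ {u v} → Walk Adj u v → Walk Adj v u
  walk-rev s here = here
  walk-rev s (step a p) = walk-++ (walk-rev s p) (step (s a) here)

  walk-closed : (C : X → Set) → (∀ {p q} → C p → Adj p q → C q) → ∀ {u v} → C u → Walk Adj u v → C v
  walk-closed C h cu here = cu
  walk-closed C h cu (step a p) = walk-closed C h (h cu a) p

  conn-extend : (∀ {x y} → Adj x y → Adj y x) → (Vt Vt′ : X → Set) → Connected Vt′ Adj →
    (∀ x → Vt x → Σ X λ x′ → Vt′ x′ × Walk Adj x x′) → Connected Vt Adj
  conn-extend s Vt Vt′ c h u v hu hv with h u hu | h v hv
  ... | u′ , hu′ , wu | v′ , hv′ , wv = walk-++ wu (walk-++ (c u′ v′ hu′ hv′) (walk-rev s wv))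

module _ {X Y : Set} {Adj : X → X → Set} {Adj′ : Y → Y → Set} where

  walk-map : (f : X → Y) → (∀ {p q} → Adj p q → f p ≡ f q ⊎ Adj′ (f p) (f q)) → ∀ {u v} → Walk Adj u v → Walk Adj′ (f u) (f v)
  walk-map f h here = here
  walk-map f h (step {u} {v} a p) with h a
  ... | inj₁ eq = subst (λ z → Walk Adj′ z (f _)) (sym eq) (walk-map f h p)
  ... | inj₂ a′ = step a′ (walk-map f h p)

module _ {X : Set} {Adj Adj′ : X → X → Set} where

  walk-replace : (∀ {p q} → Adj p q → Walk Adj′ p q) → ∀ {u v} → Walk Adj u v → Walk Adj′ u v
  walk-replace h here = here
  walk-replace h (step a p) = walk-++ (h a) (walk-replace h p)

  walk-mono : (∀ {p q} → Adj p q → Adj′ p q) → ∀ {u v} → Walk Adj u v → Walk Adj′ u v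
  walk-mono h = walk-replace (λ a → step (h a) here)

  cycle-mono : (∀ {p q} → Adj p q → Adj′ p q) → ∀ {v vs} → IsCycle Adj v vs → IsCycle Adj′ v vs
  cycle-mono h (u , l , k) = u , l , Linked.map h k

module _ {X : Set} {R : X → X → Set} where

  linked-prefix : ∀ xs y ys → Linked R (xs ++ y ∷ ys) → Linked R (xs ++ [ y ])
  linked-prefix [] y [] l = [-]
  linked-prefix [] y (z ∷ ys) l = [-]
  linked-prefix (x ∷ []) y ys (a ∷ l) = a ∷ [-]
  linked-prefix (x ∷ x′ ∷ xs) y ys (a ∷ l) = a ∷ linked-prefix (x′ ∷ xs) y ys l

  linked-snoc : ∀ xs y z → Linked R (xs ++ [ y ]) → R y z → Linked R ((xs ++ [ y ]) ++ [ z ])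
  linked-snoc [] y z l r = r ∷ [-]
  linked-snoc (x ∷ []) y z (a ∷ l) r = a ∷ r ∷ [-]
  linked-snoc (x ∷ x′ ∷ xs) y z (a ∷ l) r = a ∷ linked-snoc (x′ ∷ xs) y z l r

module _ {X : Set} where

  consec-adj : ∀ {R : X → X → Set} {l : List X} {a b : X} → Linked R l → Consec l a b → R a b
  consec-adj {l = x ∷ y ∷ l} (r ∷ lk) (inj₁ (refl , refl)) = r
  consec-adj {l = x ∷ y ∷ l} (r ∷ lk) (inj₂ c) = consec-adj lk c

  consec-∈₁ : ∀ {l : List X} {a b : X} → Consec l a b → a ∈ l
  consec-∈₁ {x ∷ y ∷ l} (inj₁ (refl , refl)) = here refl
  consec-∈₁ {x ∷ y ∷ l} (inj₂ c) = there (consec-∈₁ c)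

  consec-∈₂ : ∀ {l : List X} {a b : X} → Consec l a b → b ∈ l
  consec-∈₂ {x ∷ y ∷ l} (inj₁ (refl , refl)) = there (here refl)
  consec-∈₂ {x ∷ y ∷ l} (inj₂ c) = there (consec-∈₂ c)

  lastOf : X → List X → X
  lastOf x [] = x
  lastOf x (y ∷ ys) = lastOf y ys

  lastOf-∈ : ∀ (x : X) xs → lastOf x xs ∈ x ∷ xs
  lastOf-∈ x [] = here refl
  lastOf-∈ x (y ∷ ys) = there (lastOf-∈ y ys)

  consec-lastOf : ∀ (v : X) A x R → Consec ((v ∷ A) ++ x ∷ R) (lastOf v A) x
  consec-lastOf v [] x R = inj₁ (refl , refl)
  consec-lastOf v (y ∷ A) x R = inj₂ (consec-lastOf y A x R)

  consec-++ : ∀ (P : List X) x b R → Consec (P ++ x ∷ b ∷ R) x b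
  consec-++ [] x b R = inj₁ (refl , refl)
  consec-++ (p ∷ []) x b R = inj₂ (inj₁ (refl , refl))
  consec-++ (p ∷ q ∷ P) x b R = inj₂ (consec-++ (q ∷ P) x b R)

  lastOf≢ : ∀ (y : X) ys → Unique (y ∷ ys) → 1 ≤ length ys → lastOf y ys ≢ y
  lastOf≢ y (z ∷ zs) u _ eq = Unique[x∷xs]⇒x∉xs u (subst (_∈ z ∷ zs) eq (lastOf-∈ z zs))

  lastOf≢head : ∀ (v : X) A x → Unique (v ∷ A ++ x ∷ []) → 2 ≤ length (A ++ x ∷ []) → lastOf v A ≢ v
  lastOf≢head v [] x u (s≤s ())
  lastOf≢head v (z ∷ A′) x u _ eq = Unique[x∷xs]⇒x∉xs u (∈-++⁺ˡ (subst (_∈ z ∷ A′) eq (lastOf-∈ z A′)))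

  closed-split : ∀ (v : X) A x B → (v ∷ A ++ x ∷ B) ∷ʳ v ≡ (v ∷ A) ++ x ∷ (B ++ [ v ])
  closed-split v A x B = cong (v ∷_) (Listₚ.++-assoc A (x ∷ B) [ v ])

  cycle-neighbours-inner : ∀ (v : X) A x B → Unique (v ∷ A ++ x ∷ B) → 2 ≤ length (A ++ x ∷ B) →
    Σ X λ a → Σ X λ b → a ≢ b × Consec ((v ∷ A ++ x ∷ B) ∷ʳ v) a x × Consec ((v ∷ A ++ x ∷ B) ∷ʳ v) x b
  cycle-neighbours-inner v A x [] u len = lastOf v A , v , lastOf≢head v A x u len ,
    subst (λ l → Consec l (lastOf v A) x) (sym (closed-split v A x [])) (consec-lastOf v A x [ v ]) ,
    subst (λ l → Consec l x v) (sym (closed-split v A x [])) (consec-++ (v ∷ A) x v [])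
  cycle-neighbours-inner v A x (y ∷ B′) u len = lastOf v A , y ,
    (λ eq → Unique-++⇒disjoint (v ∷ A) u (subst (_∈ v ∷ A) eq (lastOf-∈ v A)) (there (here refl))) ,
    subst (λ l → Consec l (lastOf v A) x) (sym (closed-split v A x (y ∷ B′))) (consec-lastOf v A x (y ∷ B′ ++ [ v ])) ,
    subst (λ l → Consec l x y) (sym (closed-split v A x (y ∷ B′))) (consec-++ (v ∷ A) x y (B′ ++ [ v ]))

  cycle-neighbours : ∀ (v : X) vs x → Unique (v ∷ vs) → 2 ≤ length vs → x ∈ v ∷ vs →
    Σ X λ a → Σ X λ b → a ≢ b × Consec ((v ∷ vs) ∷ʳ v) a x × Consec ((v ∷ vs) ∷ʳ v) x b
  cycle-neighbours v (y ∷ ys) .v u (s≤s len) (here refl) =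
    lastOf y ys , y , lastOf≢ y ys (AllPairs.tail u) len , consec-lastOf v (y ∷ ys) v [] , inj₁ (refl , refl)
  cycle-neighbours v vs x u len (there m) with ∈-∃++ m
  ... | A , B , refl = cycle-neighbours-inner v A x B u len

  ∈-closed⇒∈ : ∀ {v : X} {vs} {y} → y ∈ (v ∷ vs) ∷ʳ v → y ∈ v ∷ vs
  ∈-closed⇒∈ {v} {vs} m with ∈-++⁻ (v ∷ vs) m
  ... | inj₁ m′ = m′
  ... | inj₂ (here refl) = here refl

module UniqueLength {X : Set} (_≟_ : DecidableEquality X) where

  remove : X → List X → List X
  remove x [] = []
  remove x (y ∷ ys) with x ≟ y
  ... | yes _ = ys
  ... | no _ = y ∷ remove x ys

  remove-len : ∀ x ys → x ∈ ys → suc (length (remove x ys)) ≡ length ys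
  remove-len x (y ∷ ys) m with x ≟ y
  ... | yes _ = refl
  remove-len x (y ∷ ys) (here eq) | no ne = ⊥-elim (ne eq)
  remove-len x (y ∷ ys) (there m) | no ne = cong suc (remove-len x ys m)

  remove-∈ : ∀ x ys {z} → z ∈ ys → z ≢ x → z ∈ remove x ys
  remove-∈ x (y ∷ ys) m ne with x ≟ y
  remove-∈ x (y ∷ ys) (here refl) ne | yes refl = ⊥-elim (ne refl)
  remove-∈ x (y ∷ ys) (there m) ne | yes refl = m
  remove-∈ x (y ∷ ys) (here refl) ne | no _ = here refl
  remove-∈ x (y ∷ ys) (there m) ne | no _ = there (remove-∈ x ys m ne)

  Unique⇒length≤ : ∀ (p V : List X) → Unique p → (∀ x → x ∈ p → x ∈ V) → length p ≤ length V
  Unique⇒length≤ [] V _ _ = z≤n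
  Unique⇒length≤ (x ∷ p) V u h =
    subst (suc (length p) ≤_) (remove-len x V (h x (here refl)))
      (s≤s (Unique⇒length≤ p (remove x V) (AllPairs.tail u)
         (λ z m → remove-∈ x V (h z (there m)) (λ eq → Unique[x∷xs]⇒x∉xs u (subst (_∈ p) eq m)))))

module CycleSearch {X : Set} (_≟_ : DecidableEquality X) (Adj : X → X → Set)
  (symA : ∀ {x y} → Adj x y → Adj y x) (irr : ∀ {x} → Adj x x → ⊥)
  (P : X → Set) (U : List X) (inU : ∀ x → P x → x ∈ U)
  (two-neighbours : ∀ x → P x → Σ X λ y → Σ X λ y′ → y ≢ y′ × Adj x y × Adj x y′ × P y × P y′) where

  open DecMembership _≟_ using (_∈?_)
  open UniqueLength _≟_ using (Unique⇒length≤)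

  All⇒∈U : ∀ {xs : List X} → All P xs → ∀ x → x ∈ xs → x ∈ U
  All⇒∈U (px ∷ _) x (here refl) = inU x px
  All⇒∈U (_ ∷ ps) x (there m) = All⇒∈U ps x m

  Cycle : Set
  Cycle = Σ X λ v → Σ (List X) λ vs → IsCycle Adj v vs

  close-cycle : ∀ u r rest′ w → Unique (u ∷ r ∷ rest′) → Linked Adj (u ∷ r ∷ rest′) → Adj u w → w ∈ rest′ → Cycle
  close-cycle u r rest′ w un ln a m with ∈-∃++ m
  ... | A , B , refl = u , r ∷ A ++ [ w ] , un′ , len , lk
    where
    eqL : (u ∷ r ∷ A) ++ w ∷ B ≡ ((u ∷ r ∷ A) ++ [ w ]) ++ B
    eqL = sym (Listₚ.++-assoc (u ∷ r ∷ A) [ w ] B)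
    un′ : Unique (u ∷ r ∷ A ++ [ w ])
    un′ = Unique-++⁻ˡ ((u ∷ r ∷ A) ++ [ w ]) (subst Unique eqL un)
    len : 2 ≤ length (r ∷ A ++ [ w ])
    len = s≤s (subst (1 ≤_) (sym (Listₚ.length-++ A {[ w ]})) (ℕₚ.m≤n+m 1 (length A)))
    lk : Linked Adj ((u ∷ r ∷ A ++ [ w ]) ∷ʳ u)
    lk = linked-snoc (u ∷ r ∷ A) w u (linked-prefix (u ∷ r ∷ A) w B ln) (symA a)

  close-cycle′ : ∀ u rest w → Unique (u ∷ rest) → Linked Adj (u ∷ rest) → Adj u w →
    (∀ {r : X} {rest′ : List X} → rest ≡ r ∷ rest′ → w ≢ r) → w ∈ rest → Cycle
  close-cycle′ u (r ∷ rest′) w un ln a nr (here refl) = ⊥-elim (nr refl refl)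
  close-cycle′ u (r ∷ rest′) w un ln a nr (there m′) = close-cycle u r rest′ w un ln a m′

  -- Extend the path u ∷ rest (read backwards) by a neighbour of u other than its predecessor;
  -- a neighbour already on the path closes a cycle, and the path cannot outgrow U.
  choose : ∀ u rest → P u → Σ X λ w → Adj u w × P w × (∀ {r : X} {rest′ : List X} → rest ≡ r ∷ rest′ → w ≢ r)
  choose u [] pu with two-neighbours u pu
  ... | y , y′ , ne , a , a′ , py , py′ = y , a , py , λ ()
  choose u (r ∷ rest) pu with two-neighbours u pu
  ... | y , y′ , ne , a , a′ , py , py′ with y ≟ r
  ... | yes refl = y′ , a′ , py′ , λ { refl eq → ne (sym eq) }
  ... | no ¬p = y , a , py , λ { refl eq → ¬p eq }

  grow : ∀ (k : ℕ) (u : X) (rest : List X) → Unique (u ∷ rest) → Linked Adj (u ∷ rest) → All P (u ∷ rest) →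
    length U < k + length (u ∷ rest) → Cycle
  grow zero u rest un ln ap lt =
    ⊥-elim (ℕₚ.<-irrefl refl (ℕₚ.<-≤-trans lt (Unique⇒length≤ (u ∷ rest) U un (All⇒∈U ap))))
  grow (suc k) u rest un ln ap@(pu ∷ _) lt with choose u rest pu
  ... | w , a , pw , nr with w ∈? (u ∷ rest)
  ... | no w∉ = grow k w (u ∷ rest) (Unique-cons w∉ un) (symA a ∷ ln) (pw ∷ ap)
                  (subst (length U <_) (sym (ℕₚ.+-suc k (length (u ∷ rest)))) lt)
  ... | yes (here refl) = ⊥-elim (irr a)
  ... | yes (there m) = close-cycle′ u rest w un ln a nr m

  cycle : ∀ s → P s → Cycle
  cycle s ps = grow (suc (length U)) s [] ([] ∷ []) [-] (ps ∷ []) (s≤s (ℕₚ.m≤m+n (length U) 1))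

module _ {N : ℕ} where

  module RemE = Removal (_≟E_ {N})
  module RemT = Removal (_≟T_ {N})
  module RemV = Removal (Fin._≟_ {N})

  count-edges-of : ∀ (t : Tri N) (q : Edge N → Bool) →
    count (λ e → (e ⊂ᵗ t) ∧ q e) (allEdge N) ≡ b2n (q (eAB t)) + (b2n (q (eAC t)) + (b2n (q (eBC t)) + 0))
  count-edges-of t q = trans (RemE.count-restrict p (allEdge N) edges allEdge-unique edges-unique
                                (λ x _ → allEdge-complete x) edges-complete)
                             (trans (count≡sumL p edges) on-edges)
    where
    p : Edge N → Bool
    p e = (e ⊂ᵗ t) ∧ q e
    edges : List (Edge N)
    edges = eAB t ∷ eAC t ∷ eBC t ∷ []
    edges-unique : Unique edges
    edges-unique = (eAB≢eAC t ∷ eAB≢eBC t ∷ []) ∷ (eAC≢eBC t ∷ []) ∷ [] ∷ []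
    edges-complete : ∀ x → x ∈ allEdge N → T (p x) → x ∈ edges
    edges-complete x _ h with ⊂ᵗ-sound {e = x} {t = t} (T-∧-l {x ⊂ᵗ t} h)
    ... | inj₁ refl = here refl
    ... | inj₂ (inj₁ refl) = there (here refl)
    ... | inj₂ (inj₂ refl) = there (there (here refl))
    p≡q : ∀ e → T (e ⊂ᵗ t) → p e ≡ q e
    p≡q e h rewrite T-true h = refl
    on-edges : sumL (λ e → b2n (p e)) edges ≡ b2n (q (eAB t)) + (b2n (q (eAC t)) + (b2n (q (eBC t)) + 0))
    on-edges = cong₂ _+_ (cong b2n (p≡q _ (eAB⊂ t)))
                 (cong₂ _+_ (cong b2n (p≡q _ (eAC⊂ t))) (cong₂ _+_ (cong b2n (p≡q _ (eBC⊂ t))) refl))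

  edges-of-at : ∀ (t : Tri N) (v : Fin N) →
    b2n (v ∈ᵉ eAB t) + (b2n (v ∈ᵉ eAC t) + (b2n (v ∈ᵉ eBC t) + 0)) ≡ 2 * b2n (v ∈ᵗ t)
  edges-of-at t@(tri a b c p q) v with v Fin.≟ a | v Fin.≟ b | v Fin.≟ c
  ... | yes refl | yes e2 | _ = ⊥-elim (a≢b-T t e2)
  ... | yes refl | no _ | yes e3 = ⊥-elim (a≢c-T t e3)
  ... | yes refl | no n2 | no n3 = refl
  ... | no n1 | yes refl | yes e3 = ⊥-elim (b≢c-T t e3)
  ... | no n1 | yes refl | no n3 = refl
  ... | no n1 | no n2 | yes refl = refl
  ... | no n1 | no n2 | no n3 = refl

  count-edges-of-at : ∀ (t : Tri N) (v : Fin N) →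
    count (λ e → (e ⊂ᵗ t) ∧ (v ∈ᵉ e)) (allEdge N) ≡ 2 * b2n (v ∈ᵗ t)
  count-edges-of-at t v = trans (count-edges-of t (v ∈ᵉ_)) (edges-of-at t v)

-- Pointwise form of 2|E| = Σₑ deg e + |∂K|, which needs all degrees to be at most 2.
twice-edge-indicator : ∀ (k r : Bool) (d : ℕ) → d ≤ 2 → (T k → 1 ≤ d) → (1 ≤ d → T k) →
  2 * b2n (k ∧ r) ≡ b2n r * d + b2n ((d ≡ᵇ 1) ∧ r)
twice-edge-indicator true r zero _ h _ with h tt
... | ()
twice-edge-indicator false true zero _ _ _ = refl
twice-edge-indicator false false zero _ _ _ = refl
twice-edge-indicator false r (suc d) _ _ h with h (s≤s z≤n)
... | ()
twice-edge-indicator true true 1 _ _ _ = refl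
twice-edge-indicator true false 1 _ _ _ = refl
twice-edge-indicator true true 2 _ _ _ = refl
twice-edge-indicator true false 2 _ _ _ = refl
twice-edge-indicator true r (suc (suc (suc d))) (s≤s (s≤s ())) _ _

-- count₂ sums through a function local to its definition; the mutual block names that
-- function (as a solved meta) so that the sum can be unfolded by induction on the list.
mutual
  count₂-over : ∀ {n} → (Tri n → Edge n → Bool) → List (Tri n) → ℕ
  count₂-over = _

  count₂-unfold : ∀ {n} (p : Tri n → Edge n → Bool) → count₂ p ≡ count₂-over p (allTri n)
  count₂-unfold {n} p with allTri n
  ... | L = refl

count₂-over≡sumL : ∀ {n} (p : Tri n → Edge n → Bool) L →
  count₂-over p L ≡ sumL (λ t → count (p t) (allEdge n)) L
count₂-over≡sumL p [] = refl
count₂-over≡sumL {n} p (t ∷ ts) = cong (count (p t) (allEdge n) +_) (count₂-over≡sumL p ts)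

count₂≡sumL : ∀ {n} (p : Tri n → Edge n → Bool) → count₂ p ≡ sumL (λ t → count (p t) (allEdge n)) (allTri n)
count₂≡sumL {n} p = trans (count₂-unfold p) (count₂-over≡sumL p (allTri n))

module Props {N : ℕ} (K : Tri N → Bool) where
  open Complex K public

  -- B′ of the statement, for z_{t,e} = x_t and y = edgeK.
  zK : Tri N → Edge N → Bool
  zK t _ = K t

  BV : Tri N ⊎ Edge N → Set
  BV = BVert K edgeK

  BA : Tri N ⊎ Edge N → Tri N ⊎ Edge N → Set
  BA = BAdj zK

  trianglesAt : Fin N → ℕ
  trianglesAt v = count (λ t → K t ∧ (v ∈ᵗ t)) (allTri N)

  edgesAt : Fin N → ℕ
  edgesAt v = count (λ e → edgeK e ∧ (v ∈ᵉ e)) (allEdge N)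

  boundary : Edge N → Bool
  boundary e = triDeg e ≡ᵇ 1

  boundaryAt : Fin N → ℕ
  boundaryAt v = count (λ e → boundary e ∧ (v ∈ᵉ e)) (allEdge N)

  anyL-sound : ∀ {A : Set} (p : A → Bool) L → T (anyL p L) → Σ A λ x → x ∈ L × T (p x)
  anyL-sound p (x ∷ xs) h with T-∨-elim {p x} h
  ... | inj₁ px = x , here refl , px
  ... | inj₂ r with anyL-sound p xs r
  ... | y , m , py = y , there m , py

  anyL-intro : ∀ {A : Set} (p : A → Bool) L {x} → x ∈ L → T (p x) → T (anyL p L)
  anyL-intro p (y ∷ ys) (here refl) h = T-∨-l h
  anyL-intro p (y ∷ ys) (there m) h = T-∨-r {p y} (anyL-intro p ys m h)

  edgeK⇒triDeg≥1 : ∀ e → T (edgeK e) → 1 ≤ triDeg e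
  edgeK⇒triDeg≥1 e h with anyL-sound (λ t → K t ∧ (e ⊂ᵗ t)) (allTri N) h
  ... | t , m , pt = ∃⇒count≥1 (λ t → K t ∧ (e ⊂ᵗ t)) (allTri N) m pt

  triDeg≥1⇒edgeK : ∀ e → 1 ≤ triDeg e → T (edgeK e)
  triDeg≥1⇒edgeK e h with count≥1⇒∃ (λ t → K t ∧ (e ⊂ᵗ t)) (allTri N) h
  ... | t , m , pt = anyL-intro (λ t → K t ∧ (e ⊂ᵗ t)) (allTri N) m pt

  edgeK-intro : ∀ e t → T (K t) → T (e ⊂ᵗ t) → T (edgeK e)
  edgeK-intro e t kt s = anyL-intro (λ t → K t ∧ (e ⊂ᵗ t)) (allTri N) (allTri-complete t) (T-∧-intro kt s)

  edgeK-elim : ∀ e → T (edgeK e) → Σ (Tri N) λ t → T (K t) × T (e ⊂ᵗ t)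
  edgeK-elim e h with anyL-sound (λ t → K t ∧ (e ⊂ᵗ t)) (allTri N) h
  ... | t , _ , pt = t , T-∧-l {K t} pt , T-∧-r {K t} pt

  boundary⇒triDeg≡1 : ∀ e → T (boundary e) → triDeg e ≡ 1
  boundary⇒triDeg≡1 e h = ℕₚ.≡ᵇ⇒≡ (triDeg e) 1 h

  triDeg≡1⇒boundary : ∀ e → triDeg e ≡ 1 → T (boundary e)
  triDeg≡1⇒boundary e h = ℕₚ.≡⇒≡ᵇ (triDeg e) 1 h

  double-count : ∀ (q : Edge N → Bool) →
    sumL (λ e → b2n (q e) * triDeg e) (allEdge N) ≡
    sumL (λ t → b2n (K t) * count (λ e → (e ⊂ᵗ t) ∧ q e) (allEdge N)) (allTri N)
  double-count q =
    begin
      sumL (λ e → b2n (q e) * triDeg e) (allEdge N)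
        ≡⟨ sumL-ext (allEdge N) (λ e _ → trans (cong (b2n (q e) *_) (count≡sumL (λ t → K t ∧ (e ⊂ᵗ t)) (allTri N)))
                                    (sym (sumL-* (b2n (q e)) (λ t → b2n (K t ∧ (e ⊂ᵗ t))) (allTri N)))) ⟩
      sumL (λ e → sumL (λ t → b2n (q e) * b2n (K t ∧ (e ⊂ᵗ t))) (allTri N)) (allEdge N)
        ≡⟨ sumL-ext (allEdge N) (λ e _ → sumL-ext (allTri N) (λ t _ → pointwise e t)) ⟩
      sumL (λ e → sumL (λ t → b2n (K t) * b2n ((e ⊂ᵗ t) ∧ q e)) (allTri N)) (allEdge N)
        ≡⟨ sumL-swap (λ e t → b2n (K t) * b2n ((e ⊂ᵗ t) ∧ q e)) (allEdge N) (allTri N) ⟩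
      sumL (λ t → sumL (λ e → b2n (K t) * b2n ((e ⊂ᵗ t) ∧ q e)) (allEdge N)) (allTri N)
        ≡⟨ sumL-ext (allTri N) (λ t _ → trans (sumL-* (b2n (K t)) (λ e → b2n ((e ⊂ᵗ t) ∧ q e)) (allEdge N))
                                    (cong (b2n (K t) *_) (sym (count≡sumL (λ e → (e ⊂ᵗ t) ∧ q e) (allEdge N))))) ⟩
      sumL (λ t → b2n (K t) * count (λ e → (e ⊂ᵗ t) ∧ q e) (allEdge N)) (allTri N) ∎
    where
    pointwise : ∀ e t → b2n (q e) * b2n (K t ∧ (e ⊂ᵗ t)) ≡ b2n (K t) * b2n ((e ⊂ᵗ t) ∧ q e)
    pointwise e t with q e | K t | e ⊂ᵗ t
    ... | true | true | true = refl
    ... | true | true | false = refl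
    ... | true | false | _ = refl
    ... | false | true | true = refl
    ... | false | true | false = refl
    ... | false | false | _ = refl

  Σ-triDeg-at : ∀ v → sumL (λ e → b2n (v ∈ᵉ e) * triDeg e) (allEdge N) ≡ 2 * trianglesAt v
  Σ-triDeg-at v =
    begin
      sumL (λ e → b2n (v ∈ᵉ e) * triDeg e) (allEdge N) ≡⟨ double-count (v ∈ᵉ_) ⟩
      sumL (λ t → b2n (K t) * count (λ e → (e ⊂ᵗ t) ∧ (v ∈ᵉ e)) (allEdge N)) (allTri N)
        ≡⟨ sumL-ext (allTri N) (λ t _ → trans (cong (b2n (K t) *_) (count-edges-of-at t v)) (pointwise t)) ⟩
      sumL (λ t → 2 * b2n (K t ∧ (v ∈ᵗ t))) (allTri N) ≡⟨ sumL-* 2 _ (allTri N) ⟩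
      2 * sumL (λ t → b2n (K t ∧ (v ∈ᵗ t))) (allTri N) ≡⟨ cong (2 *_) (sym (count≡sumL _ (allTri N))) ⟩
      2 * trianglesAt v ∎
    where
    pointwise : ∀ t → b2n (K t) * (2 * b2n (v ∈ᵗ t)) ≡ 2 * b2n (K t ∧ (v ∈ᵗ t))
    pointwise t with K t | v ∈ᵗ t
    ... | true | true = refl
    ... | true | false = refl
    ... | false | _ = refl

  Σ-triDeg : sumL (λ e → b2n true * triDeg e) (allEdge N) ≡ 3 * count K (allTri N)
  Σ-triDeg =
    begin
      sumL (λ e → b2n true * triDeg e) (allEdge N) ≡⟨ double-count (λ _ → true) ⟩
      sumL (λ t → b2n (K t) * count (λ e → (e ⊂ᵗ t) ∧ true) (allEdge N)) (allTri N)
        ≡⟨ sumL-ext (allTri N) (λ t _ → trans (cong (b2n (K t) *_) (count-edges-of t (λ _ → true))) (ℕₚ.*-comm (b2n (K t)) 3)) ⟩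
      sumL (λ t → 3 * b2n (K t)) (allTri N) ≡⟨ sumL-* 3 _ (allTri N) ⟩
      3 * sumL (λ t → b2n (K t)) (allTri N) ≡⟨ cong (3 *_) (sym (count≡sumL K (allTri N))) ⟩
      3 * count K (allTri N) ∎

  boundaryEdgesOf : Tri N → ℕ
  boundaryEdgesOf t = count (λ e → (e ⊂ᵗ t) ∧ boundary e) (allEdge N)

  boundary-by-faces : count boundary (allEdge N) ≡ sumL (λ t → b2n (K t) * boundaryEdgesOf t) (allTri N)
  boundary-by-faces = trans (count≡sumL boundary (allEdge N)) (trans (sumL-ext (allEdge N) (λ e _ → pointwise e)) (double-count boundary))
    where
    pointwise : ∀ e → b2n (boundary e) ≡ b2n (boundary e) * triDeg e
    pointwise e with T? (boundary e)
    ... | yes h rewrite boundary⇒triDeg≡1 e h = refl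
    ... | no h rewrite T-false h = refl

  twice-edges : ∀ (r : Edge N → Bool) → (∀ e → triDeg e ≤ 2) →
    2 * count (λ e → edgeK e ∧ r e) (allEdge N) ≡
    sumL (λ e → b2n (r e) * triDeg e) (allEdge N) + count (λ e → boundary e ∧ r e) (allEdge N)
  twice-edges r triDeg≤2 =
    begin
      2 * count (λ e → edgeK e ∧ r e) (allEdge N) ≡⟨ cong (2 *_) (count≡sumL _ (allEdge N)) ⟩
      2 * sumL (λ e → b2n (edgeK e ∧ r e)) (allEdge N) ≡⟨ sym (sumL-* 2 _ (allEdge N)) ⟩
      sumL (λ e → 2 * b2n (edgeK e ∧ r e)) (allEdge N)
        ≡⟨ sumL-ext (allEdge N) (λ e _ → twice-edge-indicator (edgeK e) (r e) (triDeg e) (triDeg≤2 e) (edgeK⇒triDeg≥1 e) (triDeg≥1⇒edgeK e)) ⟩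
      sumL (λ e → b2n (r e) * triDeg e + b2n (boundary e ∧ r e)) (allEdge N) ≡⟨ sumL-+ _ _ (allEdge N) ⟩
      sumL (λ e → b2n (r e) * triDeg e) (allEdge N) + sumL (λ e → b2n (boundary e ∧ r e)) (allEdge N)
        ≡⟨ cong (sumL (λ e → b2n (r e) * triDeg e) (allEdge N) +_) (sym (count≡sumL _ (allEdge N))) ⟩
      sumL (λ e → b2n (r e) * triDeg e) (allEdge N) + count (λ e → boundary e ∧ r e) (allEdge N) ∎

  boundaryAt≡2 : (∀ e → triDeg e ≤ 2) → ∀ v → edgesAt v ≡ suc (trianglesAt v) → boundaryAt v ≡ 2
  boundaryAt≡2 triDeg≤2 v h = ℕₚ.+-cancelˡ-≡ (2 * trianglesAt v) _ _ (trans (sym eq) (trans (cong (2 *_) h) (ar (trianglesAt v))))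
    where
    eq : 2 * edgesAt v ≡ 2 * trianglesAt v + boundaryAt v
    eq = trans (twice-edges (v ∈ᵉ_) triDeg≤2) (cong (_+ boundaryAt v) (Σ-triDeg-at v))
    ar : ∀ x → 2 * suc x ≡ 2 * x + 2
    ar x = trans (ℕₚ.*-distribˡ-+ 2 1 x) (ℕₚ.+-comm 2 (2 * x))

  boundary-count : (∀ e → triDeg e ≤ 2) → ∀ s → count K (allTri N) + 2 ≡ s → count edgeK (allEdge N) + 3 ≡ 2 * s →
    count boundary (allEdge N) ≡ s
  boundary-count triDeg≤2 s faces edges = ℕₚ.+-cancelˡ-≡ (3 * k + 6) B s (begin
    3 * k + 6 + B     ≡⟨ solve 2 (λ k B → con 3 :* k :+ con 6 :+ B := con 3 :* k :+ B :+ con 6) refl k B ⟩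
    3 * k + B + 6     ≡⟨ cong (_+ 6) twice-E ⟨
    2 * E + 6         ≡⟨ ℕₚ.*-distribˡ-+ 2 E 3 ⟨
    2 * (E + 3)       ≡⟨ cong (2 *_) edges ⟩
    2 * (2 * s)       ≡⟨ solve 1 (λ s → con 2 :* (con 2 :* s) := con 3 :* s :+ s) refl s ⟩
    3 * s + s         ≡⟨ cong (λ m → 3 * m + s) faces ⟨
    3 * (k + 2) + s   ≡⟨ cong (_+ s) (ℕₚ.*-distribˡ-+ 3 k 2) ⟩
    3 * k + 6 + s     ∎)
    where
    open +-*-Solver using (solve; _:=_; _:+_; _:*_; con)
    k = count K (allTri N)
    E = count edgeK (allEdge N)
    B = count boundary (allEdge N)
    twice-E : 2 * E ≡ 3 * k + B
    twice-E = begin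
      2 * E                                              ≡⟨ cong (2 *_) (count-ext (allEdge N) (λ e _ → ∧-identityʳ (edgeK e))) ⟨
      2 * count (λ e → edgeK e ∧ true) (allEdge N)      ≡⟨ twice-edges (λ _ → true) triDeg≤2 ⟩
      sumL (λ e → 1 * triDeg e) (allEdge N) + count (λ e → boundary e ∧ true) (allEdge N)
        ≡⟨ cong₂ _+_ Σ-triDeg (count-ext (allEdge N) (λ e _ → ∧-identityʳ (boundary e))) ⟩
      3 * k + B                                          ∎

  BA-sym : ∀ {x y} → BA x y → BA y x
  BA-sym {inj₁ s} {inj₂ e} a = a
  BA-sym {inj₂ e} {inj₁ s} a = a

  BA-irrefl : ∀ {x} → BA x x → ⊥
  BA-irrefl {inj₁ s} ()
  BA-irrefl {inj₂ e} ()

  adjK-elim : ∀ {v x} → adjK v x → Σ (Tri N) λ s → T (K s) × T (v ∈ᵗ s) × T (x ∈ᵗ s)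
  adjK-elim {v} {x} (_ , h) = s , T-∧-l {K s} p , T-∧-l {v ∈ᵗ s} (T-∧-r {K s} p) , T-∧-r {v ∈ᵗ s} (T-∧-r {K s} p)
    where
    r = anyL-sound (λ s → K s ∧ (v ∈ᵗ s) ∧ (x ∈ᵗ s)) (allTri N) h
    s = proj₁ r
    p = proj₂ (proj₂ r)

  adjK-intro : ∀ {v x} s → v ≢ x → T (K s) → T (v ∈ᵗ s) → T (x ∈ᵗ s) → adjK v x
  adjK-intro {v} {x} s ne ks vs xs = ne , anyL-intro (λ s → K s ∧ (v ∈ᵗ s) ∧ (x ∈ᵗ s)) (allTri N) (allTri-complete s)
    (T-∧-intro ks (T-∧-intro vs xs))

  linkAdj-intro : ∀ {v x y} s → x ≢ v → y ≢ v → x ≢ y → T (K s) → T (v ∈ᵗ s) → T (x ∈ᵗ s) → T (y ∈ᵗ s) → linkAdj v x y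
  linkAdj-intro {v} {x} {y} s n1 n2 n3 ks vs xs ys = n1 , n2 , n3 ,
    anyL-intro (λ s → K s ∧ (v ∈ᵗ s) ∧ (x ∈ᵗ s) ∧ (y ∈ᵗ s)) (allTri N) (allTri-complete s)
      (T-∧-intro ks (T-∧-intro vs (T-∧-intro xs ys)))

  linkAdj-elim : ∀ {v x y} → linkAdj v x y → Σ (Tri N) λ s → T (K s) × T (v ∈ᵗ s) × T (x ∈ᵗ s) × T (y ∈ᵗ s)
  linkAdj-elim {v} {x} {y} (_ , _ , _ , h) = s , T-∧-l {K s} p , T-∧-l {v ∈ᵗ s} (T-∧-r {K s} p) ,
     T-∧-l {x ∈ᵗ s} (T-∧-r {v ∈ᵗ s} (T-∧-r {K s} p)) , T-∧-r {x ∈ᵗ s} (T-∧-r {v ∈ᵗ s} (T-∧-r {K s} p))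
    where
    r = anyL-sound (λ s → K s ∧ (v ∈ᵗ s) ∧ (x ∈ᵗ s) ∧ (y ∈ᵗ s)) (allTri N) h
    s = proj₁ r
    p = proj₂ (proj₂ r)

  linkAdj-sym : ∀ {v x y} → linkAdj v x y → linkAdj v y x
  linkAdj-sym {v} {x} {y} h@(n1 , n2 , n3 , _) = go (linkAdj-elim h)
    where
    go : (Σ (Tri N) λ s → T (K s) × T (v ∈ᵗ s) × T (x ∈ᵗ s) × T (y ∈ᵗ s)) → linkAdj v y x
    go (s , ks , vs , xs , ys) = linkAdj-intro s n2 n1 (λ eq → n3 (sym eq)) ks vs ys xs

  link-walk-in-face : ∀ v t → T (K t) → T (v ∈ᵗ t) → ∀ x y → x ≢ v → y ≢ v → T (x ∈ᵗ t) → T (y ∈ᵗ t) → Walk (linkAdj v) x y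
  link-walk-in-face v t kt vt x y nx ny xt yt with x Fin.≟ y
  ... | yes refl = here
  ... | no ne = step (linkAdj-intro t nx ny ne kt vt xt yt) here

  single-face-link-connected : ∀ v t → T (K t) → T (v ∈ᵗ t) → (∀ s → T (K s) → T (v ∈ᵗ s) → s ≡ t) →
    Connected (linkVert v) (linkAdj v)
  single-face-link-connected v t kt vt only x y hx hy =
    link-walk-in-face v t kt vt x y (λ eq → proj₁ hx (sym eq)) (λ eq → proj₁ hy (sym eq)) (in-face x (adjK-elim hx)) (in-face y (adjK-elim hy))
    where
    in-face : ∀ x → (Σ (Tri N) λ s → T (K s) × T (v ∈ᵗ s) × T (x ∈ᵗ s)) → T (x ∈ᵗ t)
    in-face x (s , ks , vs , xs) = subst (λ q → T (x ∈ᵗ q)) (only s ks vs) xs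

module _ {N : ℕ} where

  -- e is the edge {p, q}; Edge stores its ends in increasing order, so both orientations occur.
  data Ends (e : Edge N) (p q : Fin N) : Set where
    fwd : Edge.a e ≡ p → Edge.b e ≡ q → Ends e p q
    bwd : Edge.a e ≡ q → Edge.b e ≡ p → Ends e p q

  ends-sym : ∀ {e p q} → Ends e p q → Ends e q p
  ends-sym (fwd x y) = bwd x y
  ends-sym (bwd x y) = fwd x y

  ends-∈ : ∀ {e p q v} → Ends e p q → T (v ∈ᵉ e) → v ≡ p ⊎ v ≡ q
  ends-∈ {e} {v = v} E h with ∈ᵉ-sound {v = v} {e = e} h | E
  ... | inj₁ refl | fwd x y = inj₁ x
  ... | inj₁ refl | bwd x y = inj₂ x
  ... | inj₂ refl | fwd x y = inj₂ y
  ... | inj₂ refl | bwd x y = inj₁ y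

  ends-∈p : ∀ {e p q} → Ends e p q → T (p ∈ᵉ e)
  ends-∈p {e} (fwd refl _) = ∈ᵉ-a e
  ends-∈p {e} (bwd _ refl) = ∈ᵉ-b e

  ends-∈q : ∀ {e p q} → Ends e p q → T (q ∈ᵉ e)
  ends-∈q E = ends-∈p (ends-sym E)

  ends-≢ : ∀ {e p q} → Ends e p q → p ≢ q
  ends-≢ {e} (fwd refl refl) eq = a≢b-E e eq
  ends-≢ {e} (bwd refl refl) eq = a≢b-E e (sym eq)

  ends-≡ : ∀ {e f p q} → Ends e p q → Ends f p q → e ≡ f
  ends-≡ {edge a b x} {edge a′ b′ y} (fwd refl refl) (fwd refl refl) = edge-≡ refl refl
  ends-≡ {edge a b x} {edge a′ b′ y} (fwd refl refl) (bwd refl refl) = ⊥-elim (Finₚ.<-asym x y)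
  ends-≡ {edge a b x} {edge a′ b′ y} (bwd refl refl) (fwd refl refl) = ⊥-elim (Finₚ.<-asym x y)
  ends-≡ {edge a b x} {edge a′ b′ y} (bwd refl refl) (bwd refl refl) = edge-≡ refl refl

  ends-pair : ∀ {e p q p′ q′} → Ends e p q → Ends e p′ q′ → (p ≡ p′ × q ≡ q′) ⊎ (p ≡ q′ × q ≡ p′)
  ends-pair (fwd refl refl) (fwd x y) = inj₁ (x , y)
  ends-pair (fwd refl refl) (bwd x y) = inj₂ (x , y)
  ends-pair (bwd refl refl) (fwd x y) = inj₂ (y , x)
  ends-pair (bwd refl refl) (bwd x y) = inj₁ (y , x)

  ends-⊂ : ∀ {e p q} {s : Tri N} → Ends e p q → T (p ∈ᵗ s) → T (q ∈ᵗ s) → T (e ⊂ᵗ s)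
  ends-⊂ {e} {s = s} (fwd refl refl) hp hq = ⊂ᵗ-intro {e = e} {t = s} hp hq
  ends-⊂ {e} {s = s} (bwd refl refl) hp hq = ⊂ᵗ-intro {e = e} {t = s} hq hp

  edge-between : ∀ (p q : Fin N) → p ≢ q → Σ (Edge N) λ e → Ends e p q
  edge-between p q ne with Finₚ.<-cmp p q
  ... | tri< lt _ _ = edge p q lt , fwd refl refl
  ... | tri≈ _ eq _ = ⊥-elim (ne eq)
  ... | tri> _ _ gt = edge q p gt , bwd refl refl

  BoundaryAdj : (Tri N → Bool) → Fin N → Fin N → Set
  BoundaryAdj K p q = Σ (Edge N) λ e → T (Props.boundary K e) × Ends e p q

  BoundaryAdj-sym : ∀ {K p q} → BoundaryAdj K p q → BoundaryAdj K q p
  BoundaryAdj-sym (e , b , E) = e , b , ends-sym E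

  other-end : ∀ {v e} → T (v ∈ᵉ e) → Σ (Fin N) λ y → Ends e v y
  other-end {v} {e} h with ∈ᵉ-sound {v = v} {e = e} h
  ... | inj₁ refl = Edge.b e , fwd refl refl
  ... | inj₂ refl = Edge.a e , bwd refl refl

  ends-same-other : ∀ {e : Edge N} {x a y} → Ends e x a → Ends e x y → a ≡ y
  ends-same-other E E′ with ends-pair E E′
  ... | inj₁ (_ , p) = p
  ... | inj₂ (p , q) = trans q p

  BoundaryAdj-irrefl : ∀ {K x} → BoundaryAdj K x x → ⊥
  BoundaryAdj-irrefl (e , _ , E) = ends-≢ E refl

  -- The constraints (C1)–(C5) once y and z are eliminated (y_e holds iff e is an edge of K, and
  -- z_{t,e} = x_t), relative to a vertex set S so that they survive the removal of an ear.
  record Admissible (S : Fin N → Bool) (K : Tri N → Bool) : Set where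
    field
      vertices-in-S : ∀ t → T (K t) → T (S (Tri.a t)) × T (S (Tri.b t)) × T (S (Tri.c t))
      triDeg≤2 : ∀ e → Props.triDeg K e ≤ 2
      face-count : count K (allTri N) + 2 ≡ count S (allFin N)
      edge-count : count (Props.edgeK K) (allEdge N) + 3 ≡ 2 * count S (allFin N)
      local-euler : ∀ v → T (S v) → Props.edgesAt K v ≡ suc (Props.trianglesAt K v)
      B-connected : Connected (Props.BV K) (Props.BA K)
      B-acyclic : ∀ v vs → ¬ IsCycle (Props.BA K) v vs

  record DiskShape (S : Fin N → Bool) (K : Tri N → Bool) : Set where
    field
      links-connected : ∀ v → T (S v) → Connected (Props.linkVert K v) (Props.linkAdj K v)
      boundary-connected : Connected (λ u → T (S u)) (BoundaryAdj K)

  record Ear (K : Tri N → Bool) : Set where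
    field
      t : Tri N
      Kt : T (K t)
      c u w : Fin N
      e1 e2 e3 : Edge N
      E1 : Ends e1 c u
      E2 : Ends e2 c w
      E3 : Ends e3 u w
      cu : c ≢ u
      cw : c ≢ w
      uw : u ≢ w
      sub : ∀ e → T (e ⊂ᵗ t) → e ≡ e1 ⊎ e ≡ e2 ⊎ e ≡ e3
      s1 : T (e1 ⊂ᵗ t)
      s2 : T (e2 ⊂ᵗ t)
      s3 : T (e3 ⊂ᵗ t)
      vt : ∀ v → T (v ∈ᵗ t) → v ≡ c ⊎ v ≡ u ⊎ v ≡ w
      ct : T (c ∈ᵗ t)
      ut : T (u ∈ᵗ t)
      wt : T (w ∈ᵗ t)
      b1 : T (Props.boundary K e1)
      b2 : T (Props.boundary K e2)
      d3 : Props.triDeg K e3 ≡ 2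

≢1⇒≡2 : ∀ d → 1 ≤ d → d ≤ 2 → ¬ (d ≡ 1) → d ≡ 2
≢1⇒≡2 1 _ _ h = ⊥-elim (h refl)
≢1⇒≡2 2 _ _ _ = refl
≢1⇒≡2 (suc (suc (suc _))) _ (s≤s (s≤s ())) _

at-least-two-of-three : ∀ a b c → 2 ≤ b2n a + (b2n b + (b2n c + 0)) →
  (T a × T b × T c) ⊎ (T a × T b × ¬ T c) ⊎ (T a × ¬ T b × T c) ⊎ (¬ T a × T b × T c)
at-least-two-of-three true true true _ = inj₁ (tt , tt , tt)
at-least-two-of-three true true false _ = inj₂ (inj₁ (tt , tt , λ ()))
at-least-two-of-three true false true _ = inj₂ (inj₂ (inj₁ (tt , (λ ()) , tt)))
at-least-two-of-three false true true _ = inj₂ (inj₂ (inj₂ ((λ ()) , tt , tt)))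
at-least-two-of-three true false false (s≤s ())
at-least-two-of-three false true false (s≤s ())
at-least-two-of-three false false true (s≤s ())
at-least-two-of-three false false false ()

b2n<b2n*⇒ : ∀ k m → b2n k < b2n k * m → T k × 2 ≤ m
b2n<b2n*⇒ true m h = tt , subst (2 ≤_) (ℕₚ.+-identityʳ m) h
b2n<b2n*⇒ false m ()

module EarExistence {N : ℕ} (S : Fin N → Bool) (K : Tri N → Bool) (I : Admissible S K) where
  open Props K
  open Admissible I

  two-faces⇒triDeg≥2 : ∀ e s s′ → s ≢ s′ → T (K s) → T (e ⊂ᵗ s) → T (K s′) → T (e ⊂ᵗ s′) → 2 ≤ triDeg e
  two-faces⇒triDeg≥2 e s s′ ne ks es ks′ es′ = RemT.pair⇒count≥2 (λ t → K t ∧ (e ⊂ᵗ t)) (allTri N) allTri-unique s s′ ne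
    (allTri-complete s) (allTri-complete s′) (T-∧-intro ks es) (T-∧-intro ks′ es′)

  boundary-face-unique : ∀ e s s′ → triDeg e ≡ 1 → T (K s) → T (e ⊂ᵗ s) → T (K s′) → T (e ⊂ᵗ s′) → s ≡ s′
  boundary-face-unique e s s′ d ks es ks′ es′ with s ≟T s′
  ... | yes eq = eq
  ... | no ne = ⊥-elim (ℕₚ.<-irrefl (sym d) (two-faces⇒triDeg≥2 e s s′ ne ks es ks′ es′))

  two-faces⇒interior : ∀ e s s′ → s ≢ s′ → T (K s) → T (e ⊂ᵗ s) → T (K s′) → T (e ⊂ᵗ s′) → ¬ T (boundary e)
  two-faces⇒interior e s s′ ne ks es ks′ es′ b = ne (boundary-face-unique e s s′ (boundary⇒triDeg≡1 e b) ks es ks′ es′)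

  interior⇒triDeg≡2 : ∀ e → T (edgeK e) → ¬ T (boundary e) → triDeg e ≡ 2
  interior⇒triDeg≡2 e ke nb = ≢1⇒≡2 (triDeg e) (edgeK⇒triDeg≥1 e ke) (triDeg≤2 e) (λ d → nb (triDeg≡1⇒boundary e d))

  another-face : ∀ t → (Σ (Tri N) λ x → Σ (Tri N) λ y → x ≢ y × x ∈ allTri N × y ∈ allTri N × T (K x) × T (K y)) →
    Σ (Tri N) λ t′ → t′ ≢ t × T (K t′)
  another-face t (x , y , ne , _ , _ , kx , ky) with x ≟T t
  ... | yes refl = y , (λ eq → ne (sym eq)) , ky
  ... | no nx = x , nx , kx

  Star : Tri N → Tri N ⊎ Edge N → Set
  Star t (inj₁ s) = s ≡ t
  Star t (inj₂ e) = T (e ⊂ᵗ t)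

  all-boundary : ∀ t → T (boundary (eAB t)) → T (boundary (eAC t)) → T (boundary (eBC t)) →
    ∀ e → T (e ⊂ᵗ t) → T (boundary e)
  all-boundary t bab bac bbc e h with ⊂ᵗ-sound {e = e} {t = t} h
  ... | inj₁ refl = bab
  ... | inj₂ (inj₁ refl) = bac
  ... | inj₂ (inj₂ refl) = bbc

  Star-closed : ∀ t → T (K t) → (∀ e → T (e ⊂ᵗ t) → T (boundary e)) → ∀ {p q} → Star t p → BA p q → Star t q
  Star-closed t kt bdt {inj₁ s} {inj₂ e} refl a = T-∧-l {e ⊂ᵗ s} a
  Star-closed t kt bdt {inj₂ e} {inj₁ s} h a =
    sym (boundary-face-unique e t s (boundary⇒triDeg≡1 e (bdt e h)) kt h (T-∧-r {e ⊂ᵗ s} a) (T-∧-l {e ⊂ᵗ s} a))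

  no-isolated-face : ∀ t → T (K t) → T (boundary (eAB t)) → T (boundary (eAC t)) → T (boundary (eBC t)) → 2 ≤ count K (allTri N) → ⊥
  no-isolated-face t kt bab bac bbc two =
    proj₁ (proj₂ other) (walk-closed {Adj = BA} (Star t) (λ {p} {q} → Star-closed t kt (all-boundary t bab bac bbc) {p} {q}) refl
      (B-connected (inj₁ t) (inj₁ (proj₁ other)) kt (proj₂ (proj₂ other))))
    where
    other = another-face t (RemT.count≥2⇒pair K (allTri N) allTri-unique two)

  ear-at-a : ∀ t → T (K t) → T (boundary (eAB t)) → T (boundary (eAC t)) → triDeg (eBC t) ≡ 2 → Ear K
  ear-at-a t@(tri a b c p q) kt x y z = record
    { t = t ; Kt = kt ; c = a ; u = b ; w = c ; e1 = eAB t ; e2 = eAC t ; e3 = eBC t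
    ; E1 = fwd refl refl ; E2 = fwd refl refl ; E3 = fwd refl refl
    ; cu = a≢b-T t ; cw = a≢c-T t ; uw = b≢c-T t
    ; sub = λ e h → ⊂ᵗ-sound {e = e} {t = t} h
    ; s1 = eAB⊂ t ; s2 = eAC⊂ t ; s3 = eBC⊂ t
    ; vt = λ v h → ∈ᵗ-sound {v = v} {t = t} h
    ; ct = ∈ᵗ-a t ; ut = ∈ᵗ-b t ; wt = ∈ᵗ-c t
    ; b1 = x ; b2 = y ; d3 = z }

  ear-at-b : ∀ t → T (K t) → T (boundary (eAB t)) → T (boundary (eBC t)) → triDeg (eAC t) ≡ 2 → Ear K
  ear-at-b t@(tri a b c p q) kt x y z = record
    { t = t ; Kt = kt ; c = b ; u = a ; w = c ; e1 = eAB t ; e2 = eBC t ; e3 = eAC t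
    ; E1 = bwd refl refl ; E2 = fwd refl refl ; E3 = fwd refl refl
    ; cu = λ eq → a≢b-T t (sym eq) ; cw = b≢c-T t ; uw = a≢c-T t
    ; sub = sb
    ; s1 = eAB⊂ t ; s2 = eBC⊂ t ; s3 = eAC⊂ t
    ; vt = vv
    ; ct = ∈ᵗ-b t ; ut = ∈ᵗ-a t ; wt = ∈ᵗ-c t
    ; b1 = x ; b2 = y ; d3 = z }
    where
    sb : ∀ e → T (e ⊂ᵗ t) → e ≡ eAB t ⊎ e ≡ eBC t ⊎ e ≡ eAC t
    sb e h with ⊂ᵗ-sound {e = e} {t = t} h
    ... | inj₁ r = inj₁ r
    ... | inj₂ (inj₁ r) = inj₂ (inj₂ r)
    ... | inj₂ (inj₂ r) = inj₂ (inj₁ r)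
    vv : ∀ v → T (v ∈ᵗ t) → v ≡ b ⊎ v ≡ a ⊎ v ≡ c
    vv v h with ∈ᵗ-sound {v = v} {t = t} h
    ... | inj₁ r = inj₂ (inj₁ r)
    ... | inj₂ (inj₁ r) = inj₁ r
    ... | inj₂ (inj₂ r) = inj₂ (inj₂ r)

  ear-at-c : ∀ t → T (K t) → T (boundary (eAC t)) → T (boundary (eBC t)) → triDeg (eAB t) ≡ 2 → Ear K
  ear-at-c t@(tri a b c p q) kt x y z = record
    { t = t ; Kt = kt ; c = c ; u = a ; w = b ; e1 = eAC t ; e2 = eBC t ; e3 = eAB t
    ; E1 = bwd refl refl ; E2 = bwd refl refl ; E3 = fwd refl refl
    ; cu = λ eq → a≢c-T t (sym eq) ; cw = λ eq → b≢c-T t (sym eq) ; uw = a≢b-T t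
    ; sub = sb
    ; s1 = eAC⊂ t ; s2 = eBC⊂ t ; s3 = eAB⊂ t
    ; vt = vv
    ; ct = ∈ᵗ-c t ; ut = ∈ᵗ-a t ; wt = ∈ᵗ-b t
    ; b1 = x ; b2 = y ; d3 = z }
    where
    sb : ∀ e → T (e ⊂ᵗ t) → e ≡ eAC t ⊎ e ≡ eBC t ⊎ e ≡ eAB t
    sb e h with ⊂ᵗ-sound {e = e} {t = t} h
    ... | inj₁ r = inj₂ (inj₂ r)
    ... | inj₂ (inj₁ r) = inj₁ r
    ... | inj₂ (inj₂ r) = inj₂ (inj₁ r)
    vv : ∀ v → T (v ∈ᵗ t) → v ≡ c ⊎ v ≡ a ⊎ v ≡ b
    vv v h with ∈ᵗ-sound {v = v} {t = t} h
    ... | inj₁ r = inj₂ (inj₁ r)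
    ... | inj₂ (inj₁ r) = inj₂ (inj₂ r)
    ... | inj₂ (inj₂ r) = inj₁ r

  -- There are |S| = |K| + 2 boundary edges, so some face carries at least two of them;
  -- a face with three would be a whole component of B.
  ear-exists : 2 ≤ count K (allTri N) → Ear K
  ear-exists two = pick t (proj₁ kb) (proj₂ kb)
    where
    B≡ : count boundary (allEdge N) ≡ count S (allFin N)
    B≡ = boundary-count triDeg≤2 (count S (allFin N)) face-count edge-count
    f g : Tri N → ℕ
    f t = b2n (K t) * boundaryEdgesOf t
    g t = b2n (K t)
    lt : sumL g (allTri N) < sumL f (allTri N)
    lt = subst₂ _<_ (count≡sumL K (allTri N)) (trans face-count (trans (sym B≡) boundary-by-faces))
           (ℕₚ.m<m+n (count K (allTri N)) (s≤s z≤n))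
    found = sumL-find-< f g (allTri N) lt
    t : Tri N
    t = proj₁ found
    kb : T (K t) × 2 ≤ boundaryEdgesOf t
    kb = b2n<b2n*⇒ (K t) (boundaryEdgesOf t) (proj₂ (proj₂ found))
    pick : ∀ t → T (K t) → 2 ≤ boundaryEdgesOf t → Ear K
    pick t kt bt with at-least-two-of-three (boundary (eAB t)) (boundary (eAC t)) (boundary (eBC t)) (subst (2 ≤_) (count-edges-of t boundary) bt)
    ... | inj₁ (x , y , z) = ⊥-elim (no-isolated-face t kt x y z two)
    ... | inj₂ (inj₁ (x , y , z)) = ear-at-a t kt x y (interior⇒triDeg≡2 (eBC t) (edgeK-intro (eBC t) t kt (eBC⊂ t)) z)
    ... | inj₂ (inj₂ (inj₁ (x , y , z))) = ear-at-b t kt x z (interior⇒triDeg≡2 (eAC t) (edgeK-intro (eAC t) t kt (eAC⊂ t)) y)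
    ... | inj₂ (inj₂ (inj₂ (x , y , z))) = ear-at-c t kt y z (interior⇒triDeg≡2 (eAB t) (edgeK-intro (eAB t) t kt (eAB⊂ t)) x)

module Apex {N : ℕ} (S : Fin N → Bool) (K : Tri N → Bool) (I : Admissible S K) (E : Ear K) where
  open Props K
  open Admissible I
  open Ear E
  open EarExistence S K I

  ear-vertex-in-S : ∀ v → T (v ∈ᵗ t) → T (S v)
  ear-vertex-in-S v h with vertices-in-S t Kt | ∈ᵗ-sound {v = v} {t = t} h
  ... | x , _ , _ | inj₁ refl = x
  ... | _ , y , _ | inj₂ (inj₁ refl) = y
  ... | _ , _ , z | inj₂ (inj₂ refl) = z

  boundaryAt-apex : boundaryAt c ≡ 2
  boundaryAt-apex = boundaryAt≡2 triDeg≤2 c (local-euler c (ear-vertex-in-S c ct))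

  e1≢e2 : e1 ≢ e2
  e1≢e2 eq with ends-pair E1 (subst (λ z → Ends z c w) (sym eq) E2)
  ... | inj₁ (_ , x) = uw x
  ... | inj₂ (x , _) = cw x

  apex∉e3 : ¬ T (c ∈ᵉ e3)
  apex∉e3 h with ends-∈ E3 h
  ... | inj₁ x = cu x
  ... | inj₂ x = cw x

  interior-at-apex : ∀ e → T (c ∈ᵉ e) → e ≢ e1 → e ≢ e2 → ¬ T (boundary e)
  interior-at-apex e ce n1 n2 b = ℕₚ.<-irrefl (sym boundaryAt-apex)
    (RemE.triple⇒count≥3 (λ e → boundary e ∧ (c ∈ᵉ e)) (allEdge N) allEdge-unique e1 e2 e e1≢e2 (λ x → n1 (sym x)) (λ x → n2 (sym x))
      (allEdge-complete e1) (allEdge-complete e2) (allEdge-complete e)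
      (T-∧-intro b1 (ends-∈p E1)) (T-∧-intro b2 (ends-∈p E2)) (T-∧-intro b ce))

  ear-edges-at-apex : ∀ e → T (c ∈ᵉ e) → T (e ⊂ᵗ t) → e ≡ e1 ⊎ e ≡ e2
  ear-edges-at-apex e ce h with sub e h
  ... | inj₁ x = inj₁ x
  ... | inj₂ (inj₁ x) = inj₂ x
  ... | inj₂ (inj₂ refl) = ⊥-elim (apex∉e3 ce)

  Cell : Set
  Cell = Tri N ⊎ Edge N

  AroundApex : Cell → Set
  AroundApex (inj₁ s) = T (K s) × T (c ∈ᵗ s) × s ≢ t
  AroundApex (inj₂ e) = T (edgeK e) × T (c ∈ᵉ e) × e ≢ e1 × e ≢ e2

  cells : List Cell
  cells = map inj₁ (allTri N) ++ map inj₂ (allEdge N)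

  ∈cells : ∀ x → AroundApex x → x ∈ cells
  ∈cells (inj₁ s) _ = ∈-++⁺ˡ (∈-map⁺ inj₁ (allTri-complete s))
  ∈cells (inj₂ e) _ = ∈-++⁺ʳ (map inj₁ (allTri N)) (∈-map⁺ inj₂ (allEdge-complete e))

  TwoNeighbours : Cell → Set
  TwoNeighbours x = Σ Cell λ y → Σ Cell λ y′ → y ≢ y′ × BA x y × BA x y′ × AroundApex y × AroundApex y′

  EdgePair : (Edge N → Bool) → Set
  EdgePair p = Σ (Edge N) λ e → Σ (Edge N) λ e′ → e ≢ e′ × e ∈ allEdge N × e′ ∈ allEdge N × T (p e) × T (p e′)

  FacePair : (Tri N → Bool) → Set
  FacePair p = Σ (Tri N) λ s → Σ (Tri N) λ s′ → s ≢ s′ × s ∈ allTri N × s′ ∈ allTri N × T (p s) × T (p s′)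

  edge-around-apex : ∀ s → T (K s) → s ≢ t → ∀ e → T ((e ⊂ᵗ s) ∧ (c ∈ᵉ e)) → AroundApex (inj₂ e)
  edge-around-apex s ks ns e pe = edgeK-intro e s ks (T-∧-l {e ⊂ᵗ s} pe) , T-∧-r {e ⊂ᵗ s} pe ,
    (λ eq → two-faces⇒interior e1 s t ns ks (subst (λ q → T (q ⊂ᵗ s)) eq (T-∧-l {e ⊂ᵗ s} pe)) Kt s1 b1) ,
    (λ eq → two-faces⇒interior e2 s t ns ks (subst (λ q → T (q ⊂ᵗ s)) eq (T-∧-l {e ⊂ᵗ s} pe)) Kt s2 b2)

  face-neighbours : ∀ s → T (K s) → s ≢ t → EdgePair (λ e → (e ⊂ᵗ s) ∧ (c ∈ᵉ e)) → TwoNeighbours (inj₁ s)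
  face-neighbours s ks ns (e , e′ , ne , _ , _ , pe , pe′) =
    inj₂ e , inj₂ e′ , (λ eq → ne (Sumₚ.inj₂-injective eq)) ,
    T-∧-intro (T-∧-l {e ⊂ᵗ s} pe) ks , T-∧-intro (T-∧-l {e′ ⊂ᵗ s} pe′) ks ,
    edge-around-apex s ks ns e pe , edge-around-apex s ks ns e′ pe′

  ∉ear : ∀ e → T (c ∈ᵉ e) → e ≢ e1 → e ≢ e2 → ¬ T (e ⊂ᵗ t)
  ∉ear e ce n1 n2 h = [ n1 , n2 ]′ (ear-edges-at-apex e ce h)

  face-around-apex : ∀ e → T (c ∈ᵉ e) → e ≢ e1 → e ≢ e2 → ∀ s → T (K s ∧ (e ⊂ᵗ s)) → AroundApex (inj₁ s)
  face-around-apex e ce n1 n2 s ps = T-∧-l {K s} ps , ∈-⊂ {v = c} {e = e} {t = s} ce (T-∧-r {K s} ps) ,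
      (λ eq → ∉ear e ce n1 n2 (subst (λ q → T (e ⊂ᵗ q)) eq (T-∧-r {K s} ps)))

  edge-neighbours : ∀ e → T (c ∈ᵉ e) → e ≢ e1 → e ≢ e2 → FacePair (λ s → K s ∧ (e ⊂ᵗ s)) → TwoNeighbours (inj₂ e)
  edge-neighbours e ce n1 n2 (s , s′ , ne , _ , _ , ps , ps′) =
    inj₁ s , inj₁ s′ , (λ eq → ne (Sumₚ.inj₁-injective eq)) ,
    T-∧-intro (T-∧-r {K s} ps) (T-∧-l {K s} ps) , T-∧-intro (T-∧-r {K s′} ps′) (T-∧-l {K s′} ps′) ,
    face-around-apex e ce n1 n2 s ps , face-around-apex e ce n1 n2 s′ ps′

  two-edges-at-apex : ∀ s → T (c ∈ᵗ s) → 2 ≤ count (λ e → (e ⊂ᵗ s) ∧ (c ∈ᵉ e)) (allEdge N)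
  two-edges-at-apex s cs = subst (2 ≤_) (sym (trans (count-edges-of-at s c) (cong (λ z → 2 * b2n z) (T-true cs)))) ℕₚ.≤-refl

  interior-triDeg≥2 : ∀ e → T (edgeK e) → T (c ∈ᵉ e) → e ≢ e1 → e ≢ e2 → 2 ≤ triDeg e
  interior-triDeg≥2 e ke ce n1 n2 = subst (2 ≤_) (sym (interior⇒triDeg≡2 e ke (interior-at-apex e ce n1 n2))) ℕₚ.≤-refl

  two-neighbours : ∀ x → AroundApex x → TwoNeighbours x
  two-neighbours (inj₁ s) (ks , cs , ns) = face-neighbours s ks ns
    (RemE.count≥2⇒pair (λ e → (e ⊂ᵗ s) ∧ (c ∈ᵉ e)) (allEdge N) allEdge-unique (two-edges-at-apex s cs))
  two-neighbours (inj₂ e) (ke , ce , n1 , n2) = edge-neighbours e ce n1 n2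
    (RemT.count≥2⇒pair (λ s → K s ∧ (e ⊂ᵗ s)) (allTri N) allTri-unique (interior-triDeg≥2 e ke ce n1 n2))

  -- Around the apex, faces other than t and edges other than e1, e2 have two such neighbours
  -- in B, so one of them would lead to a cycle in B.
  no-other-face-at-apex : ∀ s → T (K s) → T (c ∈ᵗ s) → s ≢ t → ⊥
  no-other-face-at-apex s ks cs ne =
    acyclic (CycleSearch.cycle (Sumₚ.≡-dec _≟T_ _≟E_) BA (λ {x} {y} → BA-sym {x} {y}) (λ {x} → BA-irrefl {x})
             AroundApex cells ∈cells two-neighbours (inj₁ s) (ks , cs , ne))
    where
    acyclic : (Σ Cell λ v → Σ (List Cell) λ vs → IsCycle BA v vs) → ⊥
    acyclic (v , vs , cyc) = B-acyclic v vs cyc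

  apex-only-in-ear : ∀ s → T (K s) → T (c ∈ᵗ s) → s ≡ t
  apex-only-in-ear s ks cs with s ≟T t
  ... | yes eq = eq
  ... | no ne = ⊥-elim (no-other-face-at-apex s ks cs ne)

module EarRemoval {N : ℕ} (S : Fin N → Bool) (K : Tri N → Bool) (I : Admissible S K) (E : Ear K) where
  open Props K
  open Admissible I
  open Ear E
  open EarExistence S K I
  open Apex S K I E

  K′ : Tri N → Bool
  K′ = K RemT.∖ t

  S′ : Fin N → Bool
  S′ = S RemV.∖ c

  triDeg′ : Edge N → ℕ
  triDeg′ = Props.triDeg K′

  edgeK′ : Edge N → Bool
  edgeK′ = Props.edgeK K′

  K′→K : ∀ {s} → T (K′ s) → T (K s)
  K′→K {s} h = T-∧-l {K s} h

  K′≢t : ∀ {s} → T (K′ s) → s ≢ t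
  K′≢t {s} h = RemT.T-not⇒≢ (T-∧-r {K s} h)

  K′-intro : ∀ {s} → T (K s) → s ≢ t → T (K′ s)
  K′-intro ks ne = T-∧-intro ks (RemT.≢⇒T-not ne)

  count-faces-split : ∀ (q : Tri N → Bool) → count (λ s → K s ∧ q s) (allTri N) ≡ count (λ s → K′ s ∧ q s) (allTri N) + b2n (q t)
  count-faces-split q = begin
    count (λ s → K s ∧ q s) (allTri N)                                ≡⟨ RemT.count-∖ _ (allTri N) t allTri-unique (allTri-complete t) ⟩
    count ((λ s → K s ∧ q s) RemT.∖ t) (allTri N) + b2n (K t ∧ q t)
      ≡⟨ cong₂ _+_ (count-ext (allTri N) (λ s _ → ∧-swapʳ (K s) (q s) _)) (cong (λ k → b2n (k ∧ q t)) (T-true Kt)) ⟩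
    count (λ s → K′ s ∧ q s) (allTri N) + b2n (q t)                   ∎

  triDeg-split : ∀ e → triDeg e ≡ triDeg′ e + b2n (e ⊂ᵗ t)
  triDeg-split e = count-faces-split (e ⊂ᵗ_)

  trianglesAt-split : ∀ v → trianglesAt v ≡ Props.trianglesAt K′ v + b2n (v ∈ᵗ t)
  trianglesAt-split v = count-faces-split (v ∈ᵗ_)

  triDeg′≤triDeg : ∀ e → triDeg′ e ≤ triDeg e
  triDeg′≤triDeg e = subst (triDeg′ e ≤_) (sym (triDeg-split e)) (ℕₚ.m≤m+n _ _)

  triDeg′-ear-edge : ∀ e d → T (e ⊂ᵗ t) → triDeg e ≡ suc d → triDeg′ e ≡ d
  triDeg′-ear-edge e d e⊂t deg = ℕₚ.+-cancelʳ-≡ 1 _ _ (begin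
    triDeg′ e + 1               ≡⟨ cong (triDeg′ e +_) (b2n-T e⊂t) ⟨
    triDeg′ e + b2n (e ⊂ᵗ t)    ≡⟨ triDeg-split e ⟨
    triDeg e                    ≡⟨ deg ⟩
    suc d                       ≡⟨ ℕₚ.+-comm 1 d ⟩
    d + 1                       ∎)

  triDeg′-e1 : triDeg′ e1 ≡ 0
  triDeg′-e1 = triDeg′-ear-edge e1 0 s1 (boundary⇒triDeg≡1 e1 b1)

  triDeg′-e2 : triDeg′ e2 ≡ 0
  triDeg′-e2 = triDeg′-ear-edge e2 0 s2 (boundary⇒triDeg≡1 e2 b2)

  triDeg′-e3 : triDeg′ e3 ≡ 1
  triDeg′-e3 = triDeg′-ear-edge e3 1 s3 d3

  triDeg′-outside : ∀ e → ¬ T (e ⊂ᵗ t) → triDeg′ e ≡ triDeg e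
  triDeg′-outside e h = sym (trans (triDeg-split e) (trans (cong (triDeg′ e +_) (b2n-F h)) (ℕₚ.+-identityʳ _)))

  edgeK′⇒ : ∀ e → T (edgeK′ e) → T (edgeK e) × e ≢ e1 × e ≢ e2
  edgeK′⇒ e h = triDeg≥1⇒edgeK e (ℕₚ.≤-trans d1 (triDeg′≤triDeg e)) ,
    (λ { refl → ℕₚ.<-irrefl (sym triDeg′-e1) d1 }) , (λ { refl → ℕₚ.<-irrefl (sym triDeg′-e2) d1 })
    where
    d1 : 1 ≤ triDeg′ e
    d1 = Props.edgeK⇒triDeg≥1 K′ e h

  ⇒edgeK′ : ∀ e → T (edgeK e) → e ≢ e1 → e ≢ e2 → T (edgeK′ e)
  ⇒edgeK′ e ke n1 n2 = Props.triDeg≥1⇒edgeK K′ e d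
    where
    d : 1 ≤ triDeg′ e
    d with T? (e ⊂ᵗ t)
    ... | no h = subst (1 ≤_) (sym (triDeg′-outside e h)) (edgeK⇒triDeg≥1 e ke)
    ... | yes h with sub e h
    ... | inj₁ x = ⊥-elim (n1 x)
    ... | inj₂ (inj₁ x) = ⊥-elim (n2 x)
    ... | inj₂ (inj₂ refl) = subst (1 ≤_) (sym triDeg′-e3) ℕₚ.≤-refl

  edgeK′≡ : ∀ e → edgeK′ e ≡ (edgeK RemE.∖ e1 RemE.∖ e2) e
  edgeK′≡ e = T-ext f g
    where
    not₁ = not (does (e ≟E e1))
    not₂ = not (does (e ≟E e2))
    f : T (edgeK′ e) → T ((edgeK e ∧ not₁) ∧ not₂)
    f h = T-∧-intro {edgeK e ∧ not₁} {not₂} (T-∧-intro {edgeK e} {not₁} ke (RemE.≢⇒T-not n1)) (RemE.≢⇒T-not n2)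
      where
      ke = proj₁ (edgeK′⇒ e h)
      n1 = proj₁ (proj₂ (edgeK′⇒ e h))
      n2 = proj₂ (proj₂ (edgeK′⇒ e h))
    g : T ((edgeK e ∧ not₁) ∧ not₂) → T (edgeK′ e)
    g h = ⇒edgeK′ e (T-∧-l {edgeK e} {not₁} h₁) (RemE.T-not⇒≢ {x = e} {m = e1} (T-∧-r {edgeK e} {not₁} h₁))
                    (RemE.T-not⇒≢ {x = e} {m = e2} (T-∧-r {edgeK e ∧ not₁} {not₂} h))
      where
      h₁ = T-∧-l {edgeK e ∧ not₁} {not₂} h

  count-edges-split : ∀ (q : Edge N → Bool) →
    count (λ e → edgeK e ∧ q e) (allEdge N) ≡ count (λ e → edgeK′ e ∧ q e) (allEdge N) + b2n (q e2) + b2n (q e1)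
  count-edges-split q = begin
    count p (allEdge N)
      ≡⟨ RemE.count-∖∖ p (allEdge N) e1 e2 allEdge-unique (allEdge-complete e1) (allEdge-complete e2) e1≢e2 ⟩
    count (p RemE.∖ e1 RemE.∖ e2) (allEdge N) + b2n (p e2) + b2n (p e1)
      ≡⟨ cong₂ (λ m k → m + k + b2n (p e1)) (count-ext (allEdge N) (λ e _ → removed e)) (cong (λ k → b2n (k ∧ q e2)) (T-true ke2)) ⟩
    count (λ e → edgeK′ e ∧ q e) (allEdge N) + b2n (q e2) + b2n (p e1)
      ≡⟨ cong (λ k → count (λ e → edgeK′ e ∧ q e) (allEdge N) + b2n (q e2) + b2n (k ∧ q e1)) (T-true ke1) ⟩
    count (λ e → edgeK′ e ∧ q e) (allEdge N) + b2n (q e2) + b2n (q e1) ∎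
    where
    p : Edge N → Bool
    p e = edgeK e ∧ q e
    ke1 = edgeK-intro e1 t Kt s1
    ke2 = edgeK-intro e2 t Kt s2
    removed : ∀ e → (p RemE.∖ e1 RemE.∖ e2) e ≡ (edgeK′ e ∧ q e)
    removed e = begin
      ((edgeK e ∧ q e) ∧ not₁) ∧ not₂   ≡⟨ cong (_∧ not₂) (∧-swapʳ (edgeK e) (q e) not₁) ⟩
      ((edgeK e ∧ not₁) ∧ q e) ∧ not₂   ≡⟨ ∧-swapʳ (edgeK e ∧ not₁) (q e) not₂ ⟩
      ((edgeK e ∧ not₁) ∧ not₂) ∧ q e   ≡⟨ cong (_∧ q e) (edgeK′≡ e) ⟨
      edgeK′ e ∧ q e                     ∎
      where
      not₁ = not (does (e ≟E e1))
      not₂ = not (does (e ≟E e2))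

  edge-count-split : count edgeK (allEdge N) ≡ count edgeK′ (allEdge N) + 2
  edge-count-split = begin
    count edgeK (allEdge N)                          ≡⟨ count-ext (allEdge N) (λ e _ → ∧-identityʳ (edgeK e)) ⟨
    count (λ e → edgeK e ∧ true) (allEdge N)         ≡⟨ count-edges-split (λ _ → true) ⟩
    count (λ e → edgeK′ e ∧ true) (allEdge N) + 1 + 1 ≡⟨ ℕₚ.+-assoc _ 1 1 ⟩
    count (λ e → edgeK′ e ∧ true) (allEdge N) + 2    ≡⟨ cong (_+ 2) (count-ext (allEdge N) (λ e _ → ∧-identityʳ (edgeK′ e))) ⟩
    count edgeK′ (allEdge N) + 2                     ∎

  face-count-split : count K (allTri N) ≡ count K′ (allTri N) + 1
  face-count-split = RemT.count-∖-T K (allTri N) t allTri-unique (allTri-complete t) Kt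

  vertex-count-split : count S (allFin N) ≡ count S′ (allFin N) + 1
  vertex-count-split = RemV.count-∖-T S (allFin N) c (allFin⁺ N) (∈-allFin c) (ear-vertex-in-S c ct)

  edgesAt-split : ∀ v → edgesAt v ≡ Props.edgesAt K′ v + b2n (v ∈ᵉ e2) + b2n (v ∈ᵉ e1)
  edgesAt-split v = count-edges-split (v ∈ᵉ_)

  ear-edges-at : ∀ v → v ≢ c → b2n (v ∈ᵉ e2) + b2n (v ∈ᵉ e1) ≡ b2n (v ∈ᵗ t)
  ear-edges-at v nc with v Fin.≟ u | v Fin.≟ w
  ... | yes refl | yes refl = ⊥-elim (uw refl)
  ... | yes refl | no nw = trans (cong₂ _+_ (b2n-F (λ h → [ nc , nw ]′ (ends-∈ E2 h))) (b2n-T (ends-∈q E1))) (sym (b2n-T ut))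
  ... | no nu | yes refl = trans (cong₂ _+_ (b2n-T (ends-∈q E2)) (b2n-F (λ h → [ nc , nu ]′ (ends-∈ E1 h)))) (sym (b2n-T wt))
  ... | no nu | no nw = trans (cong₂ _+_ (b2n-F (λ h → [ nc , nw ]′ (ends-∈ E2 h))) (b2n-F (λ h → [ nc , nu ]′ (ends-∈ E1 h))))
                          (sym (b2n-F (λ h → [ nc , [ nu , nw ]′ ]′ (vt v h))))

  S′⇒ : ∀ {v} → T (S′ v) → T (S v) × v ≢ c
  S′⇒ {v} h = T-∧-l {S v} h , RemV.T-not⇒≢ (T-∧-r {S v} h)

  S′-intro : ∀ {v} → T (S v) → v ≢ c → T (S′ v)
  S′-intro h ne = T-∧-intro h (RemV.≢⇒T-not ne)

  local-euler-off-apex : ∀ v → T (S v) → v ≢ c → Props.edgesAt K′ v ≡ suc (Props.trianglesAt K′ v)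
  local-euler-off-apex v sv nc = ℕₚ.+-cancelʳ-≡ (b2n (v ∈ᵗ t)) _ _ (begin
      Props.edgesAt K′ v + b2n (v ∈ᵗ t) ≡⟨ cong (Props.edgesAt K′ v +_) (sym (ear-edges-at v nc)) ⟩
      Props.edgesAt K′ v + (b2n (v ∈ᵉ e2) + b2n (v ∈ᵉ e1)) ≡⟨ sym (ℕₚ.+-assoc (Props.edgesAt K′ v) _ _) ⟩
      Props.edgesAt K′ v + b2n (v ∈ᵉ e2) + b2n (v ∈ᵉ e1) ≡⟨ sym (edgesAt-split v) ⟩
      edgesAt v ≡⟨ local-euler v sv ⟩
      suc (trianglesAt v) ≡⟨ cong suc (trianglesAt-split v) ⟩
      suc (Props.trianglesAt K′ v) + b2n (v ∈ᵗ t) ∎)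

  local-euler′ : ∀ v → T (S′ v) → Props.edgesAt K′ v ≡ suc (Props.trianglesAt K′ v)
  local-euler′ v h = local-euler-off-apex v (proj₁ (S′⇒ h)) (proj₂ (S′⇒ h))

  vertices-in-S′ : ∀ s → T (K′ s) → T (S′ (Tri.a s)) × T (S′ (Tri.b s)) × T (S′ (Tri.c s))
  vertices-in-S′ s h with vertices-in-S s (K′→K h)
  ... | x , y , z = S′-intro x (nc (Tri.a s) (∈ᵗ-a s)) , S′-intro y (nc (Tri.b s) (∈ᵗ-b s)) , S′-intro z (nc (Tri.c s) (∈ᵗ-c s))
    where
    nc : ∀ x → T (x ∈ᵗ s) → x ≢ c
    nc x m refl = K′≢t h (apex-only-in-ear s (K′→K h) m)

  triDeg′≤2 : ∀ e → triDeg′ e ≤ 2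
  triDeg′≤2 e = ℕₚ.≤-trans (triDeg′≤triDeg e) (triDeg≤2 e)

  face-count′ : count K′ (allTri N) + 2 ≡ count S′ (allFin N)
  face-count′ = ℕₚ.+-cancelʳ-≡ 1 _ _ (begin
    count K′ (allTri N) + 2 + 1 ≡⟨ ℕₚ.+-assoc (count K′ (allTri N)) 2 1 ⟩
    count K′ (allTri N) + 3 ≡⟨ sym (ℕₚ.+-assoc (count K′ (allTri N)) 1 2) ⟩
    count K′ (allTri N) + 1 + 2 ≡⟨ cong (_+ 2) (sym face-count-split) ⟩
    count K (allTri N) + 2 ≡⟨ face-count ⟩
    count S (allFin N) ≡⟨ vertex-count-split ⟩
    count S′ (allFin N) + 1 ∎)

  edge-count′ : count edgeK′ (allEdge N) + 3 ≡ 2 * count S′ (allFin N)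
  edge-count′ = ℕₚ.+-cancelʳ-≡ 2 _ _ (begin
    count edgeK′ (allEdge N) + 3 + 2 ≡⟨ ℕₚ.+-assoc (count edgeK′ (allEdge N)) 3 2 ⟩
    count edgeK′ (allEdge N) + 5 ≡⟨ sym (ℕₚ.+-assoc (count edgeK′ (allEdge N)) 2 3) ⟩
    count edgeK′ (allEdge N) + 2 + 3 ≡⟨ cong (_+ 3) (sym edge-count-split) ⟩
    count edgeK (allEdge N) + 3 ≡⟨ edge-count ⟩
    2 * count S (allFin N) ≡⟨ cong (2 *_) vertex-count-split ⟩
    2 * (count S′ (allFin N) + 1) ≡⟨ ℕₚ.*-distribˡ-+ 2 (count S′ (allFin N)) 1 ⟩
    2 * count S′ (allFin N) + 2 ∎)

  BA′⇒BA : ∀ {p q} → Props.BA K′ p q → BA p q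
  BA′⇒BA {inj₁ s} {inj₂ e} h = T-∧-intro (T-∧-l {e ⊂ᵗ s} h) (K′→K (T-∧-r {e ⊂ᵗ s} h))
  BA′⇒BA {inj₂ e} {inj₁ s} h = T-∧-intro (T-∧-l {e ⊂ᵗ s} h) (K′→K (T-∧-r {e ⊂ᵗ s} h))

  B′-acyclic : ∀ v vs → ¬ IsCycle (Props.BA K′) v vs
  B′-acyclic v vs cyc = B-acyclic v vs (cycle-mono (λ {a} {b} → BA′⇒BA {a} {b}) cyc)

  -- Walks in the incidence graph of K descend to that of K′ by contracting t, e1 and e2 onto e3.
  contract : Tri N ⊎ Edge N → Tri N ⊎ Edge N
  contract (inj₁ s) with s ≟T t
  ... | yes _ = inj₂ e3
  ... | no _ = inj₁ s
  contract (inj₂ e) with e ≟E e1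
  ... | yes _ = inj₂ e3
  ... | no _ with e ≟E e2
  ... | yes _ = inj₂ e3
  ... | no _ = inj₂ e

  contract-face : ∀ s → s ≢ t → contract (inj₁ s) ≡ inj₁ s
  contract-face s ne with s ≟T t
  ... | yes eq = ⊥-elim (ne eq)
  ... | no _ = refl

  contract-edge : ∀ e → e ≢ e1 → e ≢ e2 → contract (inj₂ e) ≡ inj₂ e
  contract-edge e n1 n2 with e ≟E e1
  ... | yes eq = ⊥-elim (n1 eq)
  ... | no _ with e ≟E e2
  ... | yes eq = ⊥-elim (n2 eq)
  ... | no _ = refl

  contract-ear-edge : ∀ e → T (e ⊂ᵗ t) → contract (inj₂ e) ≡ inj₂ e3
  contract-ear-edge e h with e ≟E e1
  ... | yes _ = refl
  ... | no n1 with e ≟E e2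
  ... | yes _ = refl
  ... | no n2 with sub e h
  ... | inj₁ x = ⊥-elim (n1 x)
  ... | inj₂ (inj₁ x) = ⊥-elim (n2 x)
  ... | inj₂ (inj₂ refl) = refl

  contract-face-edge : ∀ s e → T ((e ⊂ᵗ s) ∧ K s) → contract (inj₁ s) ≡ contract (inj₂ e) ⊎ Props.BA K′ (contract (inj₁ s)) (contract (inj₂ e))
  contract-face-edge s e h with s ≟T t
  ... | yes refl = inj₁ (sym (contract-ear-edge e (T-∧-l {e ⊂ᵗ t} h)))
  ... | no ne rewrite contract-edge e (λ { refl → two-faces⇒interior e1 s t ne (T-∧-r {e1 ⊂ᵗ s} h) (T-∧-l {e1 ⊂ᵗ s} h) Kt s1 b1 })
                              (λ { refl → two-faces⇒interior e2 s t ne (T-∧-r {e2 ⊂ᵗ s} h) (T-∧-l {e2 ⊂ᵗ s} h) Kt s2 b2 }) =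
    inj₂ (T-∧-intro (T-∧-l {e ⊂ᵗ s} h) (K′-intro (T-∧-r {e ⊂ᵗ s} h) ne))

  contract-adj : ∀ {p q} → BA p q → contract p ≡ contract q ⊎ Props.BA K′ (contract p) (contract q)
  contract-adj {inj₁ s} {inj₂ e} h = contract-face-edge s e h
  contract-adj {inj₂ e} {inj₁ s} h with contract-face-edge s e h
  ... | inj₁ eq = inj₁ (sym eq)
  ... | inj₂ a = inj₂ (Props.BA-sym K′ {contract (inj₁ s)} {contract (inj₂ e)} a)

  contract-id : ∀ p → Props.BV K′ p → contract p ≡ p
  contract-id (inj₁ s) h = contract-face s (K′≢t h)
  contract-id (inj₂ e) h = contract-edge e (proj₁ (proj₂ (edgeK′⇒ e h))) (proj₂ (proj₂ (edgeK′⇒ e h)))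

  BV′⇒BV : ∀ p → Props.BV K′ p → BV p
  BV′⇒BV (inj₁ s) h = K′→K h
  BV′⇒BV (inj₂ e) h = proj₁ (edgeK′⇒ e h)

  B′-connected : Connected (Props.BV K′) (Props.BA K′)
  B′-connected p q hp hq = subst₂ (Walk (Props.BA K′)) (contract-id p hp) (contract-id q hq)
    (walk-map contract (λ {a} {b} → contract-adj {a} {b}) (B-connected p q (BV′⇒BV p hp) (BV′⇒BV q hq)))

  admissible′ : Admissible S′ K′
  admissible′ = record
    { vertices-in-S = vertices-in-S′
    ; triDeg≤2 = triDeg′≤2
    ; face-count = face-count′
    ; edge-count = edge-count′
    ; local-euler = local-euler′
    ; B-connected = B′-connected
    ; B-acyclic = B′-acyclic
    }

linkAdj-mono : ∀ {N} (K K′ : Tri N → Bool) → (∀ s → T (K′ s) → T (K s)) →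
  ∀ {v x y} → Props.linkAdj K′ v x y → Props.linkAdj K v x y
linkAdj-mono {N} K K′ K′⊆K {v} {x} {y} h@(n1 , n2 , n3 , _) with Props.linkAdj-elim K′ h
... | s , ks , vs , xs , ys = Props.linkAdj-intro K s n1 n2 n3 (K′⊆K s ks) vs xs ys

module Lift {N : ℕ} (S : Fin N → Bool) (K : Tri N → Bool) (I : Admissible S K) (E : Ear K) where
  open Props K
  open Admissible I
  open Ear E
  open EarExistence S K I
  open Apex S K I E
  open EarRemoval S K I E

  face-across-e3 : Σ (Tri N) λ s → T (K′ s) × T (e3 ⊂ᵗ s)
  face-across-e3 = go (count≥1⇒∃ (λ s → K′ s ∧ (e3 ⊂ᵗ s)) (allTri N) (subst (1 ≤_) (sym triDeg′-e3) ℕₚ.≤-refl))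
    where
    go : (Σ (Tri N) λ s → s ∈ allTri N × T (K′ s ∧ (e3 ⊂ᵗ s))) → Σ (Tri N) λ s → T (K′ s) × T (e3 ⊂ᵗ s)
    go (s , _ , p) = s , T-∧-l {K′ s} p , T-∧-r {K′ s} p

  s′ : Tri N
  s′ = proj₁ face-across-e3
  ks′ : T (K′ s′)
  ks′ = proj₁ (proj₂ face-across-e3)
  us′ : T (u ∈ᵗ s′)
  us′ = ∈-⊂ {v = u} {e = e3} {t = s′} (ends-∈p E3) (proj₂ (proj₂ face-across-e3))
  ws′ : T (w ∈ᵗ s′)
  ws′ = ∈-⊂ {v = w} {e = e3} {t = s′} (ends-∈q E3) (proj₂ (proj₂ face-across-e3))

  disk-shape-lift : DiskShape S′ K′ → DiskShape S K
  disk-shape-lift C′ = record { links-connected = links-connected-K ; boundary-connected = boundary-connected-K }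
    where
    open DiskShape C′ renaming (links-connected to links-connected′; boundary-connected to boundary-connected′)

    -- The apex sees only t. Elsewhere a link vertex seen only through t is joined inside t
    -- to u or w, which remain in the link of K′ through the face across e3.
    links-connected-K : ∀ v → T (S v) → Connected (linkVert v) (linkAdj v)
    links-connected-K v hv with v Fin.≟ c
    ... | yes refl = single-face-link-connected c t Kt ct (λ s ks cs → apex-only-in-ear s ks cs)
    ... | no nc = conn-extend (λ {a} {b} → linkAdj-sym {v} {a} {b}) (linkVert v) (Props.linkVert K′ v)
                    (λ p q hp hq → walk-mono (linkAdj-mono K K′ (λ s → K′→K)) (links-connected′ v (S′-intro hv nc) p q hp hq))
                    into-link′
      where
      into-link′ : ∀ x → linkVert v x → Σ (Fin N) λ x′ → Props.linkVert K′ v x′ × Walk (linkAdj v) x x′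
      into-link′ x hx = via-face x (proj₁ hx) (adjK-elim hx)
        where
        via-face : ∀ x → v ≢ x → (Σ (Tri N) λ s → T (K s) × T (v ∈ᵗ s) × T (x ∈ᵗ s)) →
          Σ (Fin N) λ x′ → Props.linkVert K′ v x′ × Walk (linkAdj v) x x′
        via-face x vx (s , ks , vs , xs) with s ≟T t
        ... | no ne = x , Props.adjK-intro K′ s vx (K′-intro ks ne) vs xs , here
        ... | yes refl with vt v vs
        ... | inj₁ eq = ⊥-elim (nc eq)
        ... | inj₂ (inj₁ refl) = w , Props.adjK-intro K′ s′ uw ks′ us′ ws′ , inside-t
            where
            inside-t : Walk (linkAdj u) x w
            inside-t with vt x xs
            ... | inj₁ refl = step (linkAdj-intro t cu (λ eq → uw (sym eq)) cw Kt ut ct wt) here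
            ... | inj₂ (inj₁ refl) = ⊥-elim (vx refl)
            ... | inj₂ (inj₂ refl) = here
        ... | inj₂ (inj₂ refl) = u , Props.adjK-intro K′ s′ (λ eq → uw (sym eq)) ks′ ws′ us′ , inside-t
            where
            inside-t : Walk (linkAdj w) x u
            inside-t with vt x xs
            ... | inj₁ refl = step (linkAdj-intro t cw uw cu Kt wt ct ut) here
            ... | inj₂ (inj₁ refl) = here
            ... | inj₂ (inj₂ refl) = ⊥-elim (vx refl)

    -- The one boundary edge of K′ missing from ∂K is e3 = uw, replaced by the path u c w.
    boundary-step : ∀ {p q} → BoundaryAdj K′ p q → Walk (BoundaryAdj K) p q
    boundary-step {p} {q} (e , b′ , Ep) with T? (e ⊂ᵗ t)
    ... | no nt = step (e , triDeg≡1⇒boundary e (trans (sym (triDeg′-outside e nt)) (Props.boundary⇒triDeg≡1 K′ e b′)) , Ep) here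
    ... | yes it with sub e it
    ... | inj₁ refl = ⊥-elim (ℕₚ.0≢1+n (trans (sym triDeg′-e1) (Props.boundary⇒triDeg≡1 K′ e b′)))
    ... | inj₂ (inj₁ refl) = ⊥-elim (ℕₚ.0≢1+n (trans (sym triDeg′-e2) (Props.boundary⇒triDeg≡1 K′ e b′)))
    ... | inj₂ (inj₂ refl) with ends-pair Ep E3
    ... | inj₁ (refl , refl) = step (e1 , b1 , ends-sym E1) (step (e2 , b2 , E2) here)
    ... | inj₂ (refl , refl) = step (e2 , b2 , ends-sym E2) (step (e1 , b1 , E1) here)

    boundary-connected-K : Connected (λ x → T (S x)) (BoundaryAdj K)
    boundary-connected-K = conn-extend (λ {a} {b} → BoundaryAdj-sym {K = K} {a} {b}) (λ x → T (S x)) (λ x → T (S′ x))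
      (λ p q hp hq → walk-replace (λ {a} {b} → boundary-step {a} {b}) (boundary-connected′ p q hp hq)) into-S′
      where
      into-S′ : ∀ x → T (S x) → Σ (Fin N) λ x′ → T (S′ x′) × Walk (BoundaryAdj K) x x′
      into-S′ x hx with x Fin.≟ c
      ... | yes refl = u , S′-intro (ear-vertex-in-S u ut) (λ eq → cu (sym eq)) , step (e1 , b1 , E1) here
      ... | no nc = x , S′-intro hx nc , here

module SingleTriangle {N : ℕ} (S : Fin N → Bool) (K : Tri N → Bool) (I : Admissible S K) (one : count K (allTri N) ≡ 1) where
  open Props K
  open Admissible I

  the-face : Σ (Tri N) λ s → s ∈ allTri N × T (K s)
  the-face = count≥1⇒∃ K (allTri N) (subst (1 ≤_) (sym one) ℕₚ.≤-refl)
  t : Tri N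
  t = proj₁ the-face
  Kt : T (K t)
  Kt = proj₂ (proj₂ the-face)

  unique-face : ∀ s → T (K s) → s ≡ t
  unique-face s ks with s ≟T t
  ... | yes eq = eq
  ... | no ne = ⊥-elim (ℕₚ.<-irrefl (sym one)
         (RemT.pair⇒count≥2 K (allTri N) allTri-unique s t ne (allTri-complete s) (allTri-complete t) ks Kt))

  vertex-in-face : ∀ v → T (S v) → T (v ∈ᵗ t)
  vertex-in-face v hv = via-edge (count≥1⇒∃ (λ e → edgeK e ∧ (v ∈ᵉ e)) (allEdge N) (subst (1 ≤_) (sym (local-euler v hv)) (s≤s z≤n)))
    where
    via-face′ : ∀ e → T (v ∈ᵉ e) → (Σ (Tri N) λ s → T (K s) × T (e ⊂ᵗ s)) → T (v ∈ᵗ t)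
    via-face′ e ve (s , ks , es) = subst (λ q → T (v ∈ᵗ q)) (unique-face s ks) (∈-⊂ {v = v} {e = e} {t = s} ve es)
    via-edge : (Σ (Edge N) λ e → e ∈ allEdge N × T (edgeK e ∧ (v ∈ᵉ e))) → T (v ∈ᵗ t)
    via-edge (e , _ , p) = via-face′ e (T-∧-r {edgeK e} p) (edgeK-elim e (T-∧-l {edgeK e} p))

  disk-shape : DiskShape S K
  disk-shape = record
    { links-connected = λ v hv → single-face-link-connected v t Kt (vertex-in-face v hv) (λ s ks _ → unique-face s ks)
    ; boundary-connected = boundary-connected-K }
    where
    boundary-connected-K : Connected (λ x → T (S x)) (BoundaryAdj K)
    boundary-connected-K p q hp hq with p Fin.≟ q
    ... | yes refl = here
    ... | no ne with edge-between p q ne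
    ... | e , Ep = step (e , triDeg≡1⇒boundary e deg1 , Ep) here
      where
      et : T (e ⊂ᵗ t)
      et = ends-⊂ {s = t} Ep (vertex-in-face p hp) (vertex-in-face q hq)
      deg1 : triDeg e ≡ 1
      deg1 = trans (RemT.count-restrict (λ s → K s ∧ (e ⊂ᵗ s)) (allTri N) [ t ] allTri-unique (Unique-cons (λ ()) [])
                     (λ { x (here refl) → allTri-complete x })
                     (λ x _ h → here (unique-face x (T-∧-l {K x} h))))
                   (trans (count≡sumL (λ s → K s ∧ (e ⊂ᵗ s)) [ t ]) (cong (λ z → b2n z + 0) (T-true (T-∧-intro Kt et))))

module Induction {N : ℕ} where

  faces≥1 : ∀ S K → Admissible S K → 1 ≤ count K (allTri N)
  faces≥1 S K I = face-of-edge (count≥1⇒∃ edgeK (allEdge N) edges≥1)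
    where
    open Admissible I
    open Props K
    edges≥1 : 1 ≤ count edgeK (allEdge N)
    edges≥1 = ℕₚ.+-cancelʳ-≤ 3 1 (count edgeK (allEdge N))
      (subst (4 ≤_) (trans (cong (2 *_) face-count) (sym edge-count))
        (ℕₚ.*-monoʳ-≤ 2 (ℕₚ.m≤n+m 2 (count K (allTri N)))))
    face-of-edge : (Σ (Edge N) λ e → e ∈ allEdge N × T (edgeK e)) → 1 ≤ count K (allTri N)
    face-of-edge (e , _ , ke) with edgeK-elim e ke
    ... | s , ks , _ = ∃⇒count≥1 K (allTri N) (allTri-complete s) ks

  by-ear-removal : ∀ k S K → count K (allTri N) ≡ suc k → Admissible S K → DiskShape S K
  by-ear-removal zero S K one I = SingleTriangle.disk-shape S K I one
  by-ear-removal (suc k) S K faces I =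
    Lift.disk-shape-lift S K I E (by-ear-removal k (S′ S K I E) (K′ S K I E) faces′ (admissible′ S K I E))
    where
    open EarRemoval using (S′; K′; admissible′; face-count-split)
    E : Ear K
    E = EarExistence.ear-exists S K I (subst (2 ≤_) (sym faces) (s≤s (s≤s z≤n)))
    faces′ : count (K′ S K I E) (allTri N) ≡ suc k
    faces′ = ℕₚ.suc-injective (trans (ℕₚ.+-comm 1 _) (trans (sym (face-count-split S K I E)) faces))

  disk-shape : ∀ S K → Admissible S K → DiskShape S K
  disk-shape S K I = go (count K (allTri N)) refl (faces≥1 S K I)
    where
    go : ∀ m → count K (allTri N) ≡ m → 1 ≤ m → DiskShape S K
    go (suc k) faces _ = by-ear-removal k S K faces I
module BoundaryCycle {N : ℕ} (K : Tri N → Bool) (I : Admissible (λ _ → true) K) where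
  open Props K
  open Admissible I

  two-boundary-edges : ∀ x → boundaryAt x ≡ 2
  two-boundary-edges x = boundaryAt≡2 triDeg≤2 x (local-euler x tt)

  TwoBoundaryNeighbours : Fin N → Set
  TwoBoundaryNeighbours x = Σ (Fin N) λ y → Σ (Fin N) λ y′ → y ≢ y′ × BoundaryAdj K x y × BoundaryAdj K x y′ × ⊤ × ⊤

  boundary-neighbours : ∀ x e e′ → e ≢ e′ → T (boundary e ∧ (x ∈ᵉ e)) → T (boundary e′ ∧ (x ∈ᵉ e′)) →
    (Σ (Fin N) λ y → Ends e x y) → (Σ (Fin N) λ y → Ends e′ x y) → TwoBoundaryNeighbours x
  boundary-neighbours x e e′ ne pe pe′ (y , E) (y′ , E′) =
    y , y′ , (λ eq → ne (ends-≡ E (subst (Ends e′ x) (sym eq) E′))) ,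
    (e , T-∧-l {boundary e} pe , E) , (e′ , T-∧-l {boundary e′} pe′ , E′) , tt , tt

  boundary-neighbour-pair : ∀ x → (Σ (Edge N) λ e → Σ (Edge N) λ e′ → e ≢ e′ × e ∈ allEdge N × e′ ∈ allEdge N ×
                 T (boundary e ∧ (x ∈ᵉ e)) × T (boundary e′ ∧ (x ∈ᵉ e′))) → TwoBoundaryNeighbours x
  boundary-neighbour-pair x (e , e′ , ne , _ , _ , pe , pe′) =
    boundary-neighbours x e e′ ne pe pe′ (other-end {v = x} {e = e} (T-∧-r {boundary e} pe)) (other-end {v = x} {e = e′} (T-∧-r {boundary e′} pe′))

  two-boundary-neighbours : ∀ x → ⊤ → TwoBoundaryNeighbours x
  two-boundary-neighbours x _ = boundary-neighbour-pair x
    (RemE.count≥2⇒pair (λ e → boundary e ∧ (x ∈ᵉ e)) (allEdge N) allEdge-unique (subst (2 ≤_) (sym (two-boundary-edges x)) ℕₚ.≤-refl))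

  boundary-cycle : Fin N → Σ (Fin N) λ v → Σ (List (Fin N)) λ vs → IsCycle (BoundaryAdj K) v vs
  boundary-cycle v0 = CycleSearch.cycle Fin._≟_ (BoundaryAdj K) (λ {a} {b} → BoundaryAdj-sym {K = K} {a} {b}) (λ {a} → BoundaryAdj-irrefl {K = K} {x = a})
                        (λ _ → ⊤) (allFin N) (λ x _ → ∈-allFin x) two-boundary-neighbours v0 tt

module Hamiltonian {N : ℕ} (K : Tri N → Bool) (I : Admissible (λ _ → true) K) (C : DiskShape (λ _ → true) K)
  (v : Fin N) (vs : List (Fin N)) (uq : Unique (v ∷ vs)) (len : 2 ≤ length vs) (lk : Linked (BoundaryAdj K) ((v ∷ vs) ∷ʳ v)) where
  open Props K
  open Admissible I
  open DiskShape C
  open BoundaryCycle K I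

  L : List (Fin N)
  L = v ∷ vs

  cycL : List (Fin N)
  cycL = (v ∷ vs) ∷ʳ v

  no-third-boundary-neighbour : ∀ x a b y → a ≢ b → y ≢ a → y ≢ b → BoundaryAdj K x a → BoundaryAdj K x b → BoundaryAdj K x y → ⊥
  no-third-boundary-neighbour x a b y ab ya yb (ea , ba , Ea) (eb , bb , Eb) (ey , by , Ey) = ℕₚ.<-irrefl (sym (two-boundary-edges x))
        (RemE.triple⇒count≥3 (λ e → boundary e ∧ (x ∈ᵉ e)) (allEdge N) allEdge-unique ea eb ey
           (λ eq → ab (ends-same-other Ea (subst (λ q → Ends q x b) (sym eq) Eb)))
           (λ eq → ya (sym (ends-same-other Ea (subst (λ q → Ends q x y) (sym eq) Ey))))
           (λ eq → yb (sym (ends-same-other Eb (subst (λ q → Ends q x y) (sym eq) Ey))))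
           (allEdge-complete ea) (allEdge-complete eb) (allEdge-complete ey)
           (T-∧-intro ba (ends-∈p Ea)) (T-∧-intro bb (ends-∈p Eb)) (T-∧-intro by (ends-∈p Ey)))

  boundary-neighbour-consec : ∀ {x y} → BoundaryAdj K x y → (Σ (Fin N) λ a → Σ (Fin N) λ b → a ≢ b × Consec cycL a x × Consec cycL x b) →
    Consec cycL y x ⊎ Consec cycL x y
  boundary-neighbour-consec {x} {y} ad (a , b , ab , ca , cb) with y Fin.≟ a | y Fin.≟ b
  ... | yes refl | _ = inj₁ ca
  ... | no _ | yes refl = inj₂ cb
  ... | no ya | no yb = ⊥-elim (no-third-boundary-neighbour x a b y ab ya yb (BoundaryAdj-sym {K = K} (consec-adj lk ca)) (consec-adj lk cb) ad)

  boundary-neighbour-on-cycle : ∀ {x y} → x ∈ L → BoundaryAdj K x y → Consec cycL y x ⊎ Consec cycL x y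
  boundary-neighbour-on-cycle {x} {y} m ad = boundary-neighbour-consec ad (cycle-neighbours v vs x uq len m)

  cycle-closed : ∀ {x y} → x ∈ L → BoundaryAdj K x y → y ∈ L
  cycle-closed m a = [ (λ c → ∈-closed⇒∈ (consec-∈₁ c)) , (λ c → ∈-closed⇒∈ (consec-∈₂ c)) ]′ (boundary-neighbour-on-cycle m a)

  cycle-covers : ∀ y → y ∈ L
  cycle-covers y = walk-closed {Adj = BoundaryAdj K} (_∈ L) (λ {a} {b} → cycle-closed {a} {b}) (here refl) (boundary-connected v y tt tt)

  boundary⇒cycle-edge : ∀ e → triDeg e ≡ 1 → CycEdge v vs e
  boundary⇒cycle-edge e d = [ inj₂ , inj₁ ]′ (boundary-neighbour-on-cycle (cycle-covers (Edge.a e)) (e , triDeg≡1⇒boundary e d , fwd refl refl))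

  boundary-adj⇒boundary : ∀ e → BoundaryAdj K (Edge.a e) (Edge.b e) → triDeg e ≡ 1
  boundary-adj⇒boundary e (e′ , b′ , E′) = boundary⇒triDeg≡1 e (subst (λ q → T (boundary q)) (ends-≡ E′ (fwd {e = e} refl refl)) b′)

  cycle-edge⇒boundary : ∀ e → CycEdge v vs e → triDeg e ≡ 1
  cycle-edge⇒boundary e (inj₁ c) = boundary-adj⇒boundary e (consec-adj lk c)
  cycle-edge⇒boundary e (inj₂ c) = boundary-adj⇒boundary e (BoundaryAdj-sym {K = K} (consec-adj lk c))

  hamiltonian : IsHamiltonianCycle N (λ e → triDeg e ≡ 1)
  hamiltonian = v , vs , uq , len , cycle-covers , λ e → boundary⇒cycle-edge e , cycle-edge⇒boundary e

sum≡3⇒all : ∀ a b c → b2n a + (b2n b + (b2n c + 0)) ≡ 3 → T a × T b × T c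
sum≡3⇒all true true true _ = tt , tt , tt
sum≡3⇒all true true false ()
sum≡3⇒all true false true ()
sum≡3⇒all true false false ()
sum≡3⇒all false true true ()
sum≡3⇒all false true false ()
sum≡3⇒all false false true ()
sum≡3⇒all false false false ()

module FromConstraints (n : ℕ) (3≤n : 3 ≤ n) (x : Tri n → Bool) (y : Edge n → Bool) (z : Tri n → Edge n → Bool)
  (c1 : C1 n x y z) (c2 : C2 n y z) (c3 : C3 n x y) (c4 : C4 n x y z) (c5 : C5 n x y z) where
  open Props x

  z⇒y×x : ∀ t e → T (e ⊂ᵗ t) → T (z t e) → T (y e) × T (x t)
  z⇒y×x = proj₁ c1

  z-full : ∀ t e → T (x t) → T (e ⊂ᵗ t) → T (z t e)
  z-full t e xt e⊂t with sum≡3⇒all (z t (eAB t)) (z t (eAC t)) (z t (eBC t))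
                           (trans (sym (count-edges-of t (z t))) (trans (proj₂ c1 t) (cong (λ q → 3 * b2n q) (T-true xt))))
                         | ⊂ᵗ-sound {e = e} {t = t} e⊂t
  ... | zab , _ , _ | inj₁ refl = zab
  ... | _ , zac , _ | inj₂ (inj₁ refl) = zac
  ... | _ , _ , zbc | inj₂ (inj₂ refl) = zbc

  z≡x : ∀ t e → ((e ⊂ᵗ t) ∧ z t e) ≡ (x t ∧ (e ⊂ᵗ t))
  z≡x t e = T-ext (λ h → T-∧-intro (proj₂ (z⇒y×x t e (T-∧-l {e ⊂ᵗ t} h) (T-∧-r {e ⊂ᵗ t} h))) (T-∧-l {e ⊂ᵗ t} h))
                  (λ h → T-∧-intro (T-∧-r {x t} h) (z-full t e (T-∧-l {x t} h) (T-∧-r {x t} h)))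

  zdeg≡triDeg : ∀ e → zdeg z e ≡ triDeg e
  zdeg≡triDeg e = count-ext (allTri n) (λ t _ → z≡x t e)

  y≡edgeK : ∀ e → y e ≡ edgeK e
  y≡edgeK e = T-ext y⇒edgeK edgeK⇒y
    where
    y⇒edgeK : T (y e) → T (edgeK e)
    y⇒edgeK h = triDeg≥1⇒edgeK e (subst (1 ≤_) (zdeg≡triDeg e) (subst (_≤ zdeg z e) (b2n-T h) (proj₁ (c2 e))))
    edgeK⇒y : T (edgeK e) → T (y e)
    edgeK⇒y h with T? (y e)
    ... | yes p = p
    ... | no p = ⊥-elim (ℕₚ.<⇒≱ (s≤s z≤n) (ℕₚ.≤-trans (subst (1 ≤_) (sym (zdeg≡triDeg e)) (edgeK⇒triDeg≥1 e h))
                     (subst (λ k → zdeg z e ≤ 2 * k) (b2n-F p) (proj₂ (c2 e)))))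

  count-cities : count (λ (_ : Fin n) → true) (allFin n) ≡ n
  count-cities = trans (count-true (allFin n)) (Listₚ.length-tabulate (λ i → i))

  triDeg≤2 : ∀ e → triDeg e ≤ 2
  triDeg≤2 e = subst (_≤ 2) (zdeg≡triDeg e) (ℕₚ.≤-trans (proj₂ (c2 e)) (ℕₚ.*-monoʳ-≤ 2 (b2n≤1 (y e))))

  face-count : count x (allTri n) + 2 ≡ count (λ _ → true) (allFin n)
  face-count = trans (cong (_+ 2) (proj₁ c3)) (trans (ℕₚ.m∸n+n≡m (ℕₚ.≤-trans (s≤s (s≤s z≤n)) 3≤n)) (sym count-cities))

  edge-count : count edgeK (allEdge n) + 3 ≡ 2 * count (λ _ → true) (allFin n)
  edge-count = trans (cong (_+ 3) (trans (sym (count-ext (allEdge n) (λ e _ → y≡edgeK e))) (proj₂ c3)))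
          (trans (ℕₚ.m∸n+n≡m {2 * n} {3} (ℕₚ.≤-trans 3≤n (ℕₚ.m≤m+n n (n + 0)))) (cong (2 *_) (sym count-cities)))

  incidences-in-face : ∀ v t → count (λ e → (e ⊂ᵗ t) ∧ z t e ∧ x t ∧ (v ∈ᵗ t) ∧ y e ∧ (v ∈ᵉ e)) (allEdge n) ≡ 2 * b2n (x t ∧ (v ∈ᵗ t))
  incidences-in-face v t = trans (count-ext (allEdge n) (λ e _ → pointwise e)) (trans (count-edges-of t q) at-vertex)
    where
    q : Edge n → Bool
    q e = (x t ∧ (v ∈ᵗ t)) ∧ (v ∈ᵉ e)
    pointwise : ∀ e → ((e ⊂ᵗ t) ∧ z t e ∧ x t ∧ (v ∈ᵗ t) ∧ y e ∧ (v ∈ᵉ e)) ≡ ((e ⊂ᵗ t) ∧ q e)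
    pointwise e = T-ext forward backward
      where
      forward : T ((e ⊂ᵗ t) ∧ z t e ∧ x t ∧ (v ∈ᵗ t) ∧ y e ∧ (v ∈ᵉ e)) → T ((e ⊂ᵗ t) ∧ q e)
      forward h = T-∧-intro e⊂t (T-∧-intro (T-∧-intro xt vt) ve)
        where
        e⊂t = T-∧-l {e ⊂ᵗ t} h
        r1 = T-∧-r {e ⊂ᵗ t} h
        r2 = T-∧-r {z t e} r1
        xt = T-∧-l {x t} r2
        r3 = T-∧-r {x t} r2
        vt = T-∧-l {v ∈ᵗ t} r3
        r4 = T-∧-r {v ∈ᵗ t} r3
        ve = T-∧-r {y e} r4
      backward : T ((e ⊂ᵗ t) ∧ q e) → T ((e ⊂ᵗ t) ∧ z t e ∧ x t ∧ (v ∈ᵗ t) ∧ y e ∧ (v ∈ᵉ e))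
      backward h = T-∧-intro e⊂t (T-∧-intro (z-full t e xt e⊂t) (T-∧-intro xt (T-∧-intro vt (T-∧-intro ye ve))))
        where
        e⊂t = T-∧-l {e ⊂ᵗ t} h
        r1 = T-∧-r {e ⊂ᵗ t} h
        xv = T-∧-l {x t ∧ (v ∈ᵗ t)} r1
        ve = T-∧-r {x t ∧ (v ∈ᵗ t)} r1
        xt = T-∧-l {x t} xv
        vt = T-∧-r {x t} xv
        ye : T (y e)
        ye = subst T (sym (y≡edgeK e)) (edgeK-intro e t xt e⊂t)
    at-vertex : b2n (q (eAB t)) + (b2n (q (eAC t)) + (b2n (q (eBC t)) + 0)) ≡ 2 * b2n (x t ∧ (v ∈ᵗ t))
    at-vertex with x t ∧ (v ∈ᵗ t) in eq
    ... | false = refl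
    ... | true = trans (edges-of-at t v) (cong (λ w → 2 * b2n w) (T-true (T-∧-r {x t} (true-T eq))))

  local-euler : ∀ v → T true → edgesAt v ≡ suc (trianglesAt v)
  local-euler v _ = ℕₚ.+-cancelˡ-≡ (trianglesAt v) _ _ (begin
    trianglesAt v + edgesAt v ≡⟨ cong (trianglesAt v +_) (count-ext (allEdge n) (λ e _ → cong (_∧ (v ∈ᵉ e)) (sym (y≡edgeK e)))) ⟩
    trianglesAt v + count (λ e → y e ∧ (v ∈ᵉ e)) (allEdge n) ≡⟨ c5 v ⟩
    count₂ (λ t e → (e ⊂ᵗ t) ∧ z t e ∧ x t ∧ (v ∈ᵗ t) ∧ y e ∧ (v ∈ᵉ e)) + 1
      ≡⟨ cong (_+ 1) (count₂≡sumL {n} (λ t e → (e ⊂ᵗ t) ∧ z t e ∧ x t ∧ (v ∈ᵗ t) ∧ y e ∧ (v ∈ᵉ e))) ⟩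
    sumL (λ t → count (λ e → (e ⊂ᵗ t) ∧ z t e ∧ x t ∧ (v ∈ᵗ t) ∧ y e ∧ (v ∈ᵉ e)) (allEdge n)) (allTri n) + 1
      ≡⟨ cong (_+ 1) (sumL-ext (allTri n) (λ t _ → incidences-in-face v t)) ⟩
    sumL (λ t → 2 * b2n (x t ∧ (v ∈ᵗ t))) (allTri n) + 1 ≡⟨ cong (_+ 1) (sumL-* 2 _ (allTri n)) ⟩
    2 * sumL (λ t → b2n (x t ∧ (v ∈ᵗ t))) (allTri n) + 1 ≡⟨ cong (λ q → 2 * q + 1) (sym (count≡sumL _ (allTri n))) ⟩
    2 * trianglesAt v + 1 ≡⟨ solve 1 (λ a → con 2 :* a :+ con 1 := a :+ (con 1 :+ a)) refl (trianglesAt v) ⟩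
    trianglesAt v + suc (trianglesAt v) ∎)
    where open +-*-Solver using (solve; _:=_; _:+_; _:*_; con)

  BAdj-z⇒BA : ∀ {p q} → BAdj z p q → BA p q
  BAdj-z⇒BA {inj₁ t} {inj₂ e} h = T-∧-intro (T-∧-l {e ⊂ᵗ t} h) (proj₂ (z⇒y×x t e (T-∧-l {e ⊂ᵗ t} h) (T-∧-r {e ⊂ᵗ t} h)))
  BAdj-z⇒BA {inj₂ e} {inj₁ t} h = T-∧-intro (T-∧-l {e ⊂ᵗ t} h) (proj₂ (z⇒y×x t e (T-∧-l {e ⊂ᵗ t} h) (T-∧-r {e ⊂ᵗ t} h)))

  BA⇒BAdj-z : ∀ {p q} → BA p q → BAdj z p q
  BA⇒BAdj-z {inj₁ t} {inj₂ e} h = T-∧-intro (T-∧-l {e ⊂ᵗ t} h) (z-full t e (T-∧-r {e ⊂ᵗ t} h) (T-∧-l {e ⊂ᵗ t} h))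
  BA⇒BAdj-z {inj₂ e} {inj₁ t} h = T-∧-intro (T-∧-l {e ⊂ᵗ t} h) (z-full t e (T-∧-r {e ⊂ᵗ t} h) (T-∧-l {e ⊂ᵗ t} h))

  BV⇒BVert : ∀ p → BV p → BVert x y p
  BV⇒BVert (inj₁ t) h = h
  BV⇒BVert (inj₂ e) h = subst T (sym (y≡edgeK e)) h

  admissible : Admissible (λ _ → true) x
  admissible = record
    { vertices-in-S = λ _ _ → tt , tt , tt
    ; triDeg≤2 = triDeg≤2
    ; face-count = face-count
    ; edge-count = edge-count
    ; local-euler = local-euler
    ; B-connected = λ p q hp hq → walk-mono (λ {a} {b} → BAdj-z⇒BA {a} {b}) (proj₁ (proj₂ c4) p q (BV⇒BVert p hp) (BV⇒BVert q hq))
    ; B-acyclic = λ v vs cy → proj₂ (proj₂ c4) v vs (cycle-mono (λ {a} {b} → BA⇒BAdj-z {a} {b}) cy)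
    }

-- The vertex v₀ only serves to rule out an empty vertex set.
module FullComplex {N : ℕ} (K : Tri N → Bool) (I : Admissible (λ _ → true) K) (v₀ : Fin N) where
  open Props K
  open Admissible I

  shape : DiskShape (λ _ → true) K
  shape = Induction.disk-shape (λ _ → true) K I

  vertK-all : ∀ v → T (vertK v)
  vertK-all v with count≥1⇒∃ (λ e → edgeK e ∧ (v ∈ᵉ e)) (allEdge N) (subst (1 ≤_) (sym (local-euler v tt)) (s≤s z≤n))
  ... | e , _ , p with edgeK-elim e (T-∧-l {edgeK e} p)
  ...   | s , ks , es = anyL-intro (λ t → K t ∧ (v ∈ᵗ t)) (allTri N) (allTri-complete s)
                          (T-∧-intro ks (∈-⊂ {v = v} {e = e} {t = s} (T-∧-r {edgeK e} p) es))

  same-or-adjacent : ∀ s p q → T (K s) → T (p ∈ᵗ s) → T (q ∈ᵗ s) → p ≡ q ⊎ adjK p q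
  same-or-adjacent s p q ks ps qs with p Fin.≟ q
  ... | yes eq = inj₁ eq
  ... | no ne = inj₂ (adjK-intro s ne ks ps qs)

  representative : Tri N ⊎ Edge N → Fin N
  representative (inj₁ s) = Tri.a s
  representative (inj₂ e) = Edge.a e

  representative-adj : ∀ {p q} → BA p q → representative p ≡ representative q ⊎ adjK (representative p) (representative q)
  representative-adj {inj₁ s} {inj₂ e} h =
    same-or-adjacent s (Tri.a s) (Edge.a e) (T-∧-r {e ⊂ᵗ s} h) (∈ᵗ-a s) (⊂ᵗ-a {e = e} {t = s} (T-∧-l {e ⊂ᵗ s} h))
  representative-adj {inj₂ e} {inj₁ s} h =
    same-or-adjacent s (Edge.a e) (Tri.a s) (T-∧-r {e ⊂ᵗ s} h) (⊂ᵗ-a {e = e} {t = s} (T-∧-l {e ⊂ᵗ s} h)) (∈ᵗ-a s)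

  K-connected : Connected (λ v → T (vertK v)) adjK
  K-connected u w hu hw with anyL-sound (λ t → K t ∧ (u ∈ᵗ t)) (allTri N) hu | anyL-sound (λ t → K t ∧ (w ∈ᵗ t)) (allTri N) hw
  ... | s , _ , ps | s′ , _ , ps′ =
    walk-++ (to-walk (same-or-adjacent s u (Tri.a s) (T-∧-l {K s} ps) (T-∧-r {K s} ps) (∈ᵗ-a s)))
      (walk-++ (walk-map representative (λ {a} {b} → representative-adj {a} {b})
                 (B-connected (inj₁ s) (inj₁ s′) (T-∧-l {K s} ps) (T-∧-l {K s′} ps′)))
        (to-walk (same-or-adjacent s′ (Tri.a s′) w (T-∧-l {K s′} ps′) (∈ᵗ-a s′) (T-∧-r {K s′} ps′))))
    where
    to-walk : ∀ {p q} → p ≡ q ⊎ adjK p q → Walk adjK p q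
    to-walk (inj₁ refl) = here
    to-walk (inj₂ a) = step a here

  euler-characteristic : count vertK (allFin N) + count K (allTri N) ≡ count edgeK (allEdge N) + 1
  euler-characteristic = ℕₚ.+-cancelʳ-≡ 2 _ _ (begin
    V + F + 2    ≡⟨ ℕₚ.+-assoc V F 2 ⟩
    V + (F + 2)  ≡⟨ cong₂ _+_ vertices face-count ⟩
    s + s        ≡⟨ cong (s +_) (ℕₚ.+-identityʳ s) ⟨
    2 * s        ≡⟨ edge-count ⟨
    E + 3        ≡⟨ ℕₚ.+-assoc E 1 2 ⟨
    E + 1 + 2    ∎)
    where
    V = count vertK (allFin N)
    F = count K (allTri N)
    E = count edgeK (allEdge N)
    s = count (λ _ → true) (allFin N)
    vertices : V ≡ s
    vertices = count-ext (allFin N) (λ v _ → T-true (vertK-all v))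

  boundary-nonempty : ∃ λ e → triDeg e ≡ 1
  boundary-nonempty with count≥1⇒∃ (λ e → boundary e ∧ (v₀ ∈ᵉ e)) (allEdge N)
                           (subst (1 ≤_) (sym (boundaryAt≡2 triDeg≤2 v₀ (local-euler v₀ tt))) (s≤s z≤n))
  ... | e , _ , p = e , boundary⇒triDeg≡1 e (T-∧-l {boundary e} p)

  triangulated-disk : Complex.IsTriangulatedDisk K
  triangulated-disk =
    (λ e h → edgeK⇒triDeg≥1 e h , triDeg≤2 e) , (λ v _ → DiskShape.links-connected shape v tt) ,
    K-connected , euler-characteristic , boundary-nonempty

  boundary-hamiltonian : IsHamiltonianCycle N (λ e → triDeg e ≡ 1)
  boundary-hamiltonian = from-cycle (BoundaryCycle.boundary-cycle K I v₀)
    where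
    from-cycle : (Σ (Fin N) λ v → Σ (List (Fin N)) λ vs → IsCycle (BoundaryAdj K) v vs) →
      IsHamiltonianCycle N (λ e → triDeg e ≡ 1)
    from-cycle (v , vs , uq , len , lk) = Hamiltonian.hamiltonian K I shape v vs uq len lk

IsHamiltonianCycle-resp : ∀ {n} {P Q : Edge n → Set} → (∀ e → P e → Q e) → (∀ e → Q e → P e) →
  IsHamiltonianCycle n P → IsHamiltonianCycle n Q
IsHamiltonianCycle-resp P⇒Q Q⇒P (v , vs , uq , len , cover , edges) =
  v , vs , uq , len , cover , λ e → (λ q → proj₁ (edges e) (Q⇒P e q)) , (λ c → P⇒Q e (proj₂ (edges e) c))

lemma2 : (n : ℕ) → 3 ≤ n →
    (x : Tri n → Bool) (y : Edge n → Bool) (z : Tri n → Edge n → Bool) →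
    C1 n x y z → C2 n y z → C3 n x y → C4 n x y z → C5 n x y z →
    Complex.IsTriangulatedDisk x × IsHamiltonianCycle n (λ e → zdeg z e ≡ 1)
lemma2 n 3≤n x y z c1 c2 c3 c4 c5 =
  triangulated-disk ,
  IsHamiltonianCycle-resp (λ e → trans (zdeg≡triDeg e)) (λ e → trans (sym (zdeg≡triDeg e))) boundary-hamiltonian
  where
  open FromConstraints n 3≤n x y z c1 c2 c3 c4 c5
  open FullComplex x admissible (Fin.fromℕ< {0} (ℕₚ.≤-trans (s≤s z≤n) 3≤n))
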